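{- Let $(\mathbb{X},\otimes,K)$ be a linear category with monoidal coalgebra modality $(!,\delta,\varepsilon,\Delta,\mathsf{e},\mathsf{m},\mathsf{m}_K)$, and let $(\mathsf{T},\mu,\eta,\mathsf{n},\mathsf{n}_K,\lambda)$ be a $\mathsf{MELL}$ lifting monad on it. Then the Eilenberg–Moore category $\mathbb{X}^{\mathsf{T}}$, with the symmetric monoidal structure $(\mathbb{X}^{\mathsf{T}},\otimes^{\mathsf{n}},(K,\mathsf{n}_K))$, is a linear category such that the forgetful functor $U^{\mathsf{T}}:\mathbb{X}^{\mathsf{T}}\to\mathbb{X}$ preserves the linear category structure strictly; that is, $U^{\mathsf{T}}$ strictly preserves the tensor product, unit, internal hom and evaluation maps, and the monoidal coalgebra modality $(\tilde{!},\tilde\delta,\tilde\varepsilon,\tilde\Delta,\tilde{\mathsf e},\tilde{\mathsf m},\tilde{\mathsf m}_{(K,\mathsf n_K)})$ on $\mathbb{X}^{\mathsf{T}}$ satisfies $U^{\mathsf{T}}\tilde{!}=!\,U^{\mathsf{T}}$ and $U^{\mathsf T}$ sends $\tilde\delta,\tilde\varepsilon,\tilde\Delta,\tilde{\mathsf e},\tilde{\mathsf m},\tilde{\mathsf m}_{(K,\mathsf n_K)}$ to $\delta,\varepsilon,\Delta,\mathsf e,\mathsf m,\mathsf m_K$ respectively.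
   Context: Composition is written $g\circ f$. $(\mathbb{X},\otimes,K)$ denotes a symmetric monoidal category with associator $\alpha_{A,B,C}:A\otimes(B\otimes C)\to(A\otimes B)\otimes C$, unitors $\ell_A:K\otimes A\to A$, $\rho_A:A\otimes K\to A$, symmetry $\sigma$; $\tau_{A,B,C,D}:(A\otimes B)\otimes(C\otimes D)\to(A\otimes C)\otimes(B\otimes D)$ is the canonical interchange isomorphism built from $\alpha,\sigma$. A symmetric comonoidal monad $(\mathsf T,\mu,\eta,\mathsf n,\mathsf n_K)$ is a monad $(\mathsf T,\mu,\eta)$ with a natural transformation $\mathsf n_{A,B}:\mathsf T(A\otimes B)\to\mathsf T(A)\otimes\mathsf T(B)$ and a map $\mathsf n_K:\mathsf T(K)\to K$ making $\mathsf T$ a symmetric comonoidal (oplax symmetric monoidal) functor, such that $\mathsf n_{A,B}\circ\mu_{A\otimes B}=(\mu_A\otimes\mu_B)\circ\mathsf n_{\mathsf TA,\mathsf TB}\circ\mathsf T(\mathsf n_{A,B})$, $\mathsf n_K\circ\mu_K=\mathsf n_K\circ\mathsf T(\mathsf n_K)$, $\mathsf n_{A,B}\circ\eta_{A\otimes B}=\eta_A\otimes\eta_B$, $\mathsf n_K\circ\eta_K=1_K$. The Eilenberg–Moore category $\mathbb X^{\mathsf T}$ of $\mathsf T$-algebras is symmetric monoidal with $(A,\nu)\otimes^{\mathsf n}(B,\nu')=(A\otimes B,(\nu\otimes\nu')\circ\mathsf n_{A,B})$, $f\otimes^{\mathsf n}g=f\otimes g$, unit $(K,\mathsf n_K)$,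 and structure isomorphisms those of $\mathbb X$. It is a symmetric Hopf monad if the fusion operators $\mathsf h^l_{A,B}=(1_{\mathsf TA}\otimes\mu_B)\circ\mathsf n_{A,\mathsf TB}:\mathsf T(A\otimes\mathsf TB)\to\mathsf TA\otimes\mathsf TB$ and $\mathsf h^r_{A,B}=(\mu_A\otimes 1_{\mathsf TB})\circ\mathsf n_{\mathsf TA,B}:\mathsf T(\mathsf TA\otimes B)\to\mathsf TA\otimes\mathsf TB$ are natural isomorphisms. A symmetric monoidal comonad $(!,\delta,\varepsilon,\mathsf m,\mathsf m_K)$ is a comonad with a symmetric (lax) monoidal structure $\mathsf m_{A,B}:!A\otimes!B\to!(A\otimes B)$, $\mathsf m_K:K\to!K$ such that $\delta$ and $\varepsilon$ are monoidal transformations. A coalgebra modality is a comonad $(!,\delta,\varepsilon)$ with natural $\Delta_A:!A\to!A\otimes!A$, $\mathsf e_A:!A\to K$ making each $(!A,\Delta_A,\mathsf e_A)$ a cocommutative comonoid with $\delta_A$ a comonoid morphism. A monoidal coalgebra modality $(!,\delta,\varepsilon,\Delta,\mathsf e,\mathsf m,\mathsf m_K)$ is both, such that $\Delta_{A\otimes B}\circ\mathsf m_{A,B}=(\mathsf m_{A,B}\otimes\mathsf m_{A,B})\circ\tau\circ(\Delta_A\otimes\Delta_B)$, $\mathsf e_{A\otimes B}\circ\mathsf m_{A,B}=\ell_K\circ(\mathsf e_A\otimes\mathsf e_B)$, $\Delta_K\circ\mathsf m_K=(\mathsf m_K\otimes\mathsf m_K)\circ\ell_K^{ -1}$, $\mathsf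 e_K\circ\mathsf m_K=1_K$, $!(\Delta_A)\circ\delta_A=\mathsf m_{!A,!A}\circ(\delta_A\otimes\delta_A)\circ\Delta_A$, $!(\mathsf e_A)\circ\delta_A=\mathsf m_K\circ\mathsf e_A$. A linear category is a symmetric monoidal closed category with a monoidal coalgebra modality. A mixed distributive law of $(\mathsf T,\mu,\eta)$ over $(!,\delta,\varepsilon)$ is a natural $\lambda_A:\mathsf T!A\to!\mathsf TA$ with $\lambda_A\circ\mu_{!A}=!(\mu_A)\circ\lambda_{\mathsf TA}\circ\mathsf T(\lambda_A)$, $\lambda_A\circ\eta_{!A}=!(\eta_A)$, $\delta_{\mathsf TA}\circ\lambda_A=!(\lambda_A)\circ\lambda_{!A}\circ\mathsf T(\delta_A)$, $\varepsilon_{\mathsf TA}\circ\lambda_A=\mathsf T(\varepsilon_A)$. It is symmetric monoidal if moreover $!(\mathsf n_{A,B})\circ\lambda_{A\otimes B}\circ\mathsf T(\mathsf m_{A,B})=\mathsf m_{\mathsf TA,\mathsf TB}\circ(\lambda_A\otimes\lambda_B)\circ\mathsf n_{!A,!B}$ and $!(\mathsf n_K)\circ\lambda_K\circ\mathsf T(\mathsf m_K)=\mathsf m_K\circ\mathsf n_K$. An exponential lifting monad of a monoidal coalgebra modality is a symmetric comonoidal monad together with a symmetric monoidal mixed distributive law of it over the monoidal coalgebra modality; a $\mathsf{MELL}$ lifting monad on a linear category is an exponential lifting monad (for its monoidal coalgebra modality) whose underlying symmetric comonoidal monad is a symmetric Hopf monad. -}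

module Defs where

open import Level using (Level; _⊔_) renaming (suc to lsuc)
open import Relation.Binary using (IsEquivalence)
open import Relation.Binary.PropositionalEquality
  using (_≡_; refl; subst₂; cong; cong₂; trans)

record Category (o h r : Level) : Set (lsuc (o ⊔ h ⊔ r)) where
  infixr 9 _∘_
  infix 4 _≈_
  field
    Obj : Set o
    Hom : Obj → Obj → Set h
    _≈_ : ∀ {A B} → Hom A B → Hom A B → Set r
    id : ∀ {A} → Hom A A
    _∘_ : ∀ {A B C} → Hom B C → Hom A B → Hom A C
    equiv : ∀ {A B} → IsEquivalence (_≈_ {A} {B})
    ∘-resp-≈ : ∀ {A B C} {f f' : Hom B C} {g g' : Hom A B} →
               f ≈ f' → g ≈ g' → f ∘ g ≈ f' ∘ g'
    identityˡ : ∀ {A B} {f : Hom A B} → id ∘ f ≈ f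
    identityʳ : ∀ {A B} {f : Hom A B} → f ∘ id ≈ f
    assoc : ∀ {A B C D} {f : Hom A B} {g : Hom B C} {k : Hom C D} →
            (k ∘ g) ∘ f ≈ k ∘ (g ∘ f)

  module Eq {A B : Obj} = IsEquivalence (equiv {A} {B})

  record IsIso {A B : Obj} (f : Hom A B) : Set (h ⊔ r) where
    field
      inv : Hom B A
      isoˡ : inv ∘ f ≈ id
      isoʳ : f ∘ inv ≈ id

  HEq : ∀ {A A' B B'} → A ≡ A' → B ≡ B' → Hom A B → Hom A' B' → Set r
  HEq p q f g = subst₂ Hom p q f ≈ g

module _ {o h r : Level} (𝕏 : Category o h r) where
  open Category 𝕏

  record SymmetricMonoidal : Set (o ⊔ h ⊔ r) where
    infixr 10 _⊗₀_ _⊗₁_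
    field
      _⊗₀_ : Obj → Obj → Obj
      _⊗₁_ : ∀ {A B C D} → Hom A B → Hom C D → Hom (A ⊗₀ C) (B ⊗₀ D)
      K : Obj
      ⊗-identity : ∀ {A B} → id {A} ⊗₁ id {B} ≈ id
      ⊗-homomorphism : ∀ {A B C A' B' C'} {f : Hom A B} {g : Hom B C}
        {f' : Hom A' B'} {g' : Hom B' C'} →
        (g ∘ f) ⊗₁ (g' ∘ f') ≈ (g ⊗₁ g') ∘ (f ⊗₁ f')
      ⊗-resp-≈ : ∀ {A B C D} {f f' : Hom A B} {g g' : Hom C D} →
        f ≈ f' → g ≈ g' → f ⊗₁ g ≈ f' ⊗₁ g'
      α : ∀ {A B C} → Hom (A ⊗₀ (B ⊗₀ C)) ((A ⊗₀ B) ⊗₀ C)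
      α-iso : ∀ {A B C} → IsIso (α {A} {B} {C})
      α-natural : ∀ {A B C A' B' C'} {f : Hom A A'} {g : Hom B B'} {k : Hom C C'} →
        α ∘ (f ⊗₁ (g ⊗₁ k)) ≈ ((f ⊗₁ g) ⊗₁ k) ∘ α
      ℓ : ∀ {A} → Hom (K ⊗₀ A) A
      ℓ-iso : ∀ {A} → IsIso (ℓ {A})
      ℓ-natural : ∀ {A B} {f : Hom A B} → ℓ ∘ (id ⊗₁ f) ≈ f ∘ ℓ
      ρ : ∀ {A} → Hom (A ⊗₀ K) A
      ρ-iso : ∀ {A} → IsIso (ρ {A})
      ρ-natural : ∀ {A B} {f : Hom A B} → ρ ∘ (f ⊗₁ id) ≈ f ∘ ρ
      σ : ∀ {A B} → Hom (A ⊗₀ B) (B ⊗₀ A)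
      σ-natural : ∀ {A B C D} {f : Hom A B} {g : Hom C D} →
        σ ∘ (f ⊗₁ g) ≈ (g ⊗₁ f) ∘ σ
      σ-involutive : ∀ {A B} → σ {B} {A} ∘ σ {A} {B} ≈ id
      pentagon : ∀ {A B C D} →
        α {A ⊗₀ B} {C} {D} ∘ α {A} {B} {C ⊗₀ D}
          ≈ (α {A} {B} {C} ⊗₁ id {D}) ∘ (α {A} {B ⊗₀ C} {D} ∘ (id {A} ⊗₁ α {B} {C} {D}))
      triangle : ∀ {A B} → (ρ {A} ⊗₁ id {B}) ∘ α {A} {K} {B} ≈ id {A} ⊗₁ ℓ {B}
      hexagon : ∀ {A B C} →
        IsIso.inv α-iso ∘ (σ {A} {B ⊗₀ C} ∘ IsIso.inv α-iso)
          ≈ (id {B} ⊗₁ σ {A} {C}) ∘ (IsIso.inv α-iso ∘ (σ {A} {B} ⊗₁ id {C}))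

    α⁻¹ : ∀ {A B C} → Hom ((A ⊗₀ B) ⊗₀ C) (A ⊗₀ (B ⊗₀ C))
    α⁻¹ = IsIso.inv α-iso

    ℓ⁻¹ : ∀ {A} → Hom A (K ⊗₀ A)
    ℓ⁻¹ = IsIso.inv ℓ-iso

    τ : ∀ {A B C D} → Hom ((A ⊗₀ B) ⊗₀ (C ⊗₀ D)) ((A ⊗₀ C) ⊗₀ (B ⊗₀ D))
    τ = α ∘ ((id ⊗₁ α⁻¹) ∘ ((id ⊗₁ (σ ⊗₁ id)) ∘ ((id ⊗₁ α) ∘ α⁻¹)))

  record Closed (M : SymmetricMonoidal) : Set (o ⊔ h ⊔ r) where
    open SymmetricMonoidal M
    infixr 5 _⊸_
    field
      _⊸_ : Obj → Obj → Obj
      ev : ∀ {A B} → Hom ((A ⊸ B) ⊗₀ A) B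
      curry : ∀ {A B C} → Hom (C ⊗₀ A) B → Hom C (A ⊸ B)
      curry-β : ∀ {A B C} {f : Hom (C ⊗₀ A) B} → ev ∘ (curry f ⊗₁ id) ≈ f
      curry-unique : ∀ {A B C} {f : Hom (C ⊗₀ A) B} {g : Hom C (A ⊸ B)} →
        ev ∘ (g ⊗₁ id) ≈ f → g ≈ curry f

  record MonoidalCoalgebraModality (M : SymmetricMonoidal) : Set (o ⊔ h ⊔ r) where
    open SymmetricMonoidal M
    field
      !₀ : Obj → Obj
      !₁ : ∀ {A B} → Hom A B → Hom (!₀ A) (!₀ B)
      !-identity : ∀ {A} → !₁ (id {A}) ≈ id
      !-homomorphism : ∀ {A B C} {f : Hom A B} {g : Hom B C} →
        !₁ (g ∘ f) ≈ !₁ g ∘ !₁ f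
      !-resp-≈ : ∀ {A B} {f g : Hom A B} → f ≈ g → !₁ f ≈ !₁ g
      δ : ∀ {A} → Hom (!₀ A) (!₀ (!₀ A))
      ε : ∀ {A} → Hom (!₀ A) A
      δ-natural : ∀ {A B} {f : Hom A B} → δ ∘ !₁ f ≈ !₁ (!₁ f) ∘ δ
      ε-natural : ∀ {A B} {f : Hom A B} → ε ∘ !₁ f ≈ f ∘ ε
      comonad-identityˡ : ∀ {A} → ε { !₀ A} ∘ δ {A} ≈ id
      comonad-identityʳ : ∀ {A} → !₁ (ε {A}) ∘ δ {A} ≈ id
      comonad-assoc : ∀ {A} → δ { !₀ A} ∘ δ {A} ≈ !₁ (δ {A}) ∘ δ {A}
      m : ∀ {A B} → Hom (!₀ A ⊗₀ !₀ B) (!₀ (A ⊗₀ B))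
      mK : Hom K (!₀ K)
      m-natural : ∀ {A B A' B'} {f : Hom A A'} {g : Hom B B'} →
        m ∘ (!₁ f ⊗₁ !₁ g) ≈ !₁ (f ⊗₁ g) ∘ m
      m-assoc : ∀ {A B C} →
        m {A ⊗₀ B} {C} ∘ ((m {A} {B} ⊗₁ id) ∘ α)
          ≈ !₁ α ∘ (m {A} {B ⊗₀ C} ∘ (id ⊗₁ m {B} {C}))
      m-unitˡ : ∀ {A} → !₁ (ℓ {A}) ∘ (m {K} {A} ∘ (mK ⊗₁ id)) ≈ ℓ
      m-unitʳ : ∀ {A} → !₁ (ρ {A}) ∘ (m {A} {K} ∘ (id ⊗₁ mK)) ≈ ρ
      m-symmetric : ∀ {A B} → m {B} {A} ∘ σ ≈ !₁ σ ∘ m {A} {B}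
      δ-m : ∀ {A B} → δ {A ⊗₀ B} ∘ m {A} {B} ≈ !₁ (m {A} {B}) ∘ (m { !₀ A} { !₀ B} ∘ (δ ⊗₁ δ))
      δ-mK : δ {K} ∘ mK ≈ !₁ mK ∘ mK
      ε-m : ∀ {A B} → ε {A ⊗₀ B} ∘ m {A} {B} ≈ ε ⊗₁ ε
      ε-mK : ε {K} ∘ mK ≈ id
      Δ : ∀ {A} → Hom (!₀ A) (!₀ A ⊗₀ !₀ A)
      e : ∀ {A} → Hom (!₀ A) K
      Δ-natural : ∀ {A B} {f : Hom A B} → Δ ∘ !₁ f ≈ (!₁ f ⊗₁ !₁ f) ∘ Δ
      e-natural : ∀ {A B} {f : Hom A B} → e ∘ !₁ f ≈ e
      counitˡ : ∀ {A} → ℓ ∘ ((e ⊗₁ id) ∘ Δ {A}) ≈ id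
      counitʳ : ∀ {A} → ρ ∘ ((id ⊗₁ e) ∘ Δ {A}) ≈ id
      coassoc : ∀ {A} → α ∘ ((id ⊗₁ Δ) ∘ Δ {A}) ≈ (Δ ⊗₁ id) ∘ Δ {A}
      cocommutative : ∀ {A} → σ ∘ Δ {A} ≈ Δ
      δ-Δ : ∀ {A} → Δ { !₀ A} ∘ δ {A} ≈ (δ ⊗₁ δ) ∘ Δ
      δ-e : ∀ {A} → e { !₀ A} ∘ δ {A} ≈ e
      Δ-m : ∀ {A B} → Δ {A ⊗₀ B} ∘ m {A} {B} ≈ (m ⊗₁ m) ∘ (τ ∘ (Δ ⊗₁ Δ))
      e-m : ∀ {A B} → e {A ⊗₀ B} ∘ m {A} {B} ≈ ℓ ∘ (e ⊗₁ e)
      Δ-mK : Δ {K} ∘ mK ≈ (mK ⊗₁ mK) ∘ ℓ⁻¹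
      e-mK : e {K} ∘ mK ≈ id
      !Δ-δ : ∀ {A} → !₁ (Δ {A}) ∘ δ ≈ m { !₀ A} { !₀ A} ∘ ((δ ⊗₁ δ) ∘ Δ)
      !e-δ : ∀ {A} → !₁ (e {A}) ∘ δ ≈ mK ∘ e

  record LinearCategory : Set (o ⊔ h ⊔ r) where
    field
      monoidal : SymmetricMonoidal
      closed : Closed monoidal
      modality : MonoidalCoalgebraModality monoidal
    open SymmetricMonoidal monoidal public
    open Closed closed public
    open MonoidalCoalgebraModality modality public

  record Monad : Set (o ⊔ h ⊔ r) where
    field
      T₀ : Obj → Obj
      T₁ : ∀ {A B} → Hom A B → Hom (T₀ A) (T₀ B)
      T-identity : ∀ {A} → T₁ (id {A}) ≈ id
      T-homomorphism : ∀ {A B C} {f : Hom A B} {g : Hom B C} →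
        T₁ (g ∘ f) ≈ T₁ g ∘ T₁ f
      T-resp-≈ : ∀ {A B} {f g : Hom A B} → f ≈ g → T₁ f ≈ T₁ g
      μ : ∀ {A} → Hom (T₀ (T₀ A)) (T₀ A)
      η : ∀ {A} → Hom A (T₀ A)
      μ-natural : ∀ {A B} {f : Hom A B} → μ ∘ T₁ (T₁ f) ≈ T₁ f ∘ μ
      η-natural : ∀ {A B} {f : Hom A B} → η ∘ f ≈ T₁ f ∘ η
      monad-identityˡ : ∀ {A} → μ {A} ∘ T₁ (η {A}) ≈ id
      monad-identityʳ : ∀ {A} → μ {A} ∘ η {T₀ A} ≈ id
      monad-assoc : ∀ {A} → μ {A} ∘ T₁ (μ {A}) ≈ μ {A} ∘ μ {T₀ A}

  module _ (𝕋 : Monad) where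
    open Monad 𝕋

    record Algebra : Set (o ⊔ h ⊔ r) where
      field
        carrier : Obj
        act : Hom (T₀ carrier) carrier
        act-η : act ∘ η ≈ id
        act-μ : act ∘ T₁ act ≈ act ∘ μ
    open Algebra

    record AlgHom (X Y : Algebra) : Set (h ⊔ r) where
      field
        arr : Hom (carrier X) (carrier Y)
        commutes : arr ∘ act X ≈ act Y ∘ T₁ arr
    open AlgHom

    EM : Category (o ⊔ h ⊔ r) (h ⊔ r) r
    EM = record
      { Obj = Algebra
      ; Hom = AlgHom
      ; _≈_ = λ f g → arr f ≈ arr g
      ; id = λ {X} → record
          { arr = id
          ; commutes = Eq.trans identityˡ
              (Eq.sym (Eq.trans (∘-resp-≈ Eq.refl T-identity) identityʳ)) }
      ; _∘_ = λ g f → record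
          { arr = arr g ∘ arr f
          ; commutes =
              Eq.trans assoc
              (Eq.trans (∘-resp-≈ Eq.refl (commutes f))
              (Eq.trans (Eq.sym assoc)
              (Eq.trans (∘-resp-≈ (commutes g) Eq.refl)
              (Eq.trans assoc
              (∘-resp-≈ Eq.refl (Eq.sym T-homomorphism)))))) }
      ; equiv = record { refl = Eq.refl ; sym = Eq.sym ; trans = Eq.trans }
      ; ∘-resp-≈ = ∘-resp-≈
      ; identityˡ = identityˡ
      ; identityʳ = identityʳ
      ; assoc = assoc
      }

  module _ (M : SymmetricMonoidal) where
    open SymmetricMonoidal M

    record SymmetricComonoidalMonad : Set (o ⊔ h ⊔ r) where
      field
        monad : Monad
      open Monad monad public
      field
        n : ∀ {A B} → Hom (T₀ (A ⊗₀ B)) (T₀ A ⊗₀ T₀ B)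
        nK : Hom (T₀ K) K
        n-natural : ∀ {A B A' B'} {f : Hom A A'} {g : Hom B B'} →
          n ∘ T₁ (f ⊗₁ g) ≈ (T₁ f ⊗₁ T₁ g) ∘ n
        n-assoc : ∀ {A B C} →
          (n {A} {B} ⊗₁ id) ∘ (n {A ⊗₀ B} {C} ∘ T₁ α)
            ≈ α ∘ ((id ⊗₁ n {B} {C}) ∘ n {A} {B ⊗₀ C})
        n-unitˡ : ∀ {A} → ℓ ∘ ((nK ⊗₁ id) ∘ n {K} {A}) ≈ T₁ ℓ
        n-unitʳ : ∀ {A} → ρ ∘ ((id ⊗₁ nK) ∘ n {A} {K}) ≈ T₁ ρ
        n-symmetric : ∀ {A B} → σ ∘ n {A} {B} ≈ n {B} {A} ∘ T₁ σ
        n-μ : ∀ {A B} → n {A} {B} ∘ μ ≈ (μ ⊗₁ μ) ∘ (n {T₀ A} {T₀ B} ∘ T₁ (n {A} {B}))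
        nK-μ : nK ∘ μ ≈ nK ∘ T₁ nK
        n-η : ∀ {A B} → n {A} {B} ∘ η ≈ η ⊗₁ η
        nK-η : nK ∘ η ≈ id

      hˡ : ∀ {A B} → Hom (T₀ (A ⊗₀ T₀ B)) (T₀ A ⊗₀ T₀ B)
      hˡ = (id ⊗₁ μ) ∘ n
      hʳ : ∀ {A B} → Hom (T₀ (T₀ A ⊗₀ B)) (T₀ A ⊗₀ T₀ B)
      hʳ = (μ ⊗₁ id) ∘ n

    -- (naturality of the fusion operators is automatic)
    record IsHopf (𝕋 : SymmetricComonoidalMonad) : Set (o ⊔ h ⊔ r) where
      open SymmetricComonoidalMonad 𝕋
      field
        hˡ-iso : ∀ {A B} → IsIso (hˡ {A} {B})
        hʳ-iso : ∀ {A B} → IsIso (hʳ {A} {B})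

    record SymmetricMonoidalMixedDistributiveLaw
      (𝕋 : SymmetricComonoidalMonad) (Ex : MonoidalCoalgebraModality M)
      : Set (o ⊔ h ⊔ r) where
      open SymmetricComonoidalMonad 𝕋
      open MonoidalCoalgebraModality Ex
      field
        λ' : ∀ {A} → Hom (T₀ (!₀ A)) (!₀ (T₀ A))
        λ-natural : ∀ {A B} {f : Hom A B} → λ' ∘ T₁ (!₁ f) ≈ !₁ (T₁ f) ∘ λ'
        λ-μ : ∀ {A} → λ' {A} ∘ μ ≈ !₁ μ ∘ (λ' {T₀ A} ∘ T₁ (λ' {A}))
        λ-η : ∀ {A} → λ' {A} ∘ η ≈ !₁ η
        λ-δ : ∀ {A} → δ ∘ λ' {A} ≈ !₁ (λ' {A}) ∘ (λ' { !₀ A} ∘ T₁ δ)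
        λ-ε : ∀ {A} → ε ∘ λ' {A} ≈ T₁ ε
        λ-m : ∀ {A B} → !₁ (n {A} {B}) ∘ (λ' {A ⊗₀ B} ∘ T₁ (m {A} {B}))
                         ≈ m ∘ ((λ' ⊗₁ λ') ∘ n { !₀ A} { !₀ B})
        λ-mK : !₁ nK ∘ (λ' {K} ∘ T₁ mK) ≈ mK ∘ nK

  record MELLLiftingMonad (L : LinearCategory) : Set (o ⊔ h ⊔ r) where
    open LinearCategory L using (monoidal; modality)
    field
      comonoidalMonad : SymmetricComonoidalMonad monoidal
      hopf : IsHopf monoidal comonoidalMonad
      distributiveLaw : SymmetricMonoidalMixedDistributiveLaw monoidal comonoidalMonad modality
    open SymmetricComonoidalMonad comonoidalMonad public

-- The conclusion of Theorem 6.9: a linear category structure on the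
-- Eilenberg-Moore category, whose monoidal structure is ⊗ⁿ with unit
-- (K, n_K), and which the forgetful functor U^T (Algebra.carrier on
-- objects, AlgHom.arr on maps) preserves strictly.

module _ {o h r : Level} {𝕏 : Category o h r} {L : LinearCategory 𝕏}
         (𝕋 : MELLLiftingMonad 𝕏 L) where
  open Category 𝕏
  open LinearCategory L
  open MELLLiftingMonad 𝕋 using (monad; T₀; n; nK)
  open Algebra
  open AlgHom

  private
    𝔼 = EM 𝕏 monad

  record StrictLift (L' : LinearCategory 𝔼) : Set (o ⊔ h ⊔ r) where
    private
      module L' = LinearCategory {𝕏 = 𝔼} L'
    field
      ⊗-obj : ∀ A B → carrier (A L'.⊗₀ B) ≡ carrier A ⊗₀ carrier B
      ⊗-act : ∀ A B → HEq (cong T₀ (⊗-obj A B)) (⊗-obj A B)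
                (act (A L'.⊗₀ B)) ((act A ⊗₁ act B) ∘ n)
      ⊗-arr : ∀ {A B C D} (f : AlgHom 𝕏 monad A B) (g : AlgHom 𝕏 monad C D) →
        HEq (⊗-obj A C) (⊗-obj B D) (arr (f L'.⊗₁ g)) (arr f ⊗₁ arr g)
      K-obj : carrier L'.K ≡ K
      K-act : HEq (cong T₀ K-obj) K-obj (act L'.K) nK
      α-arr : ∀ {A B C} →
        HEq (trans (⊗-obj A (B L'.⊗₀ C)) (cong (carrier A ⊗₀_) (⊗-obj B C)))
            (trans (⊗-obj (A L'.⊗₀ B) C) (cong (_⊗₀ carrier C) (⊗-obj A B)))
            (arr (L'.α {A} {B} {C})) (α {carrier A} {carrier B} {carrier C})
      ℓ-arr : ∀ {A} →
        HEq (trans (⊗-obj L'.K A) (cong (_⊗₀ carrier A) K-obj)) refl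
            (arr (L'.ℓ {A})) (ℓ {carrier A})
      ρ-arr : ∀ {A} →
        HEq (trans (⊗-obj A L'.K) (cong (carrier A ⊗₀_) K-obj)) refl
            (arr (L'.ρ {A})) (ρ {carrier A})
      σ-arr : ∀ {A B} →
        HEq (⊗-obj A B) (⊗-obj B A) (arr (L'.σ {A} {B})) (σ {carrier A} {carrier B})
      ⊸-obj : ∀ A B → carrier (A L'.⊸ B) ≡ carrier A ⊸ carrier B
      ev-arr : ∀ {A B} →
        HEq (trans (⊗-obj (A L'.⊸ B) A) (cong (_⊗₀ carrier A) (⊸-obj A B))) refl
            (arr (L'.ev {A} {B})) (ev {carrier A} {carrier B})
      !-obj : ∀ A → carrier (L'.!₀ A) ≡ !₀ (carrier A)
      !-arr : ∀ {A B} (f : AlgHom 𝕏 monad A B) →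
        HEq (!-obj A) (!-obj B) (arr (L'.!₁ f)) (!₁ (arr f))
      δ-arr : ∀ {A} →
        HEq (!-obj A) (trans (!-obj (L'.!₀ A)) (cong !₀ (!-obj A)))
            (arr (L'.δ {A})) (δ {carrier A})
      ε-arr : ∀ {A} → HEq (!-obj A) refl (arr (L'.ε {A})) (ε {carrier A})
      Δ-arr : ∀ {A} →
        HEq (!-obj A) (trans (⊗-obj (L'.!₀ A) (L'.!₀ A)) (cong₂ _⊗₀_ (!-obj A) (!-obj A)))
            (arr (L'.Δ {A})) (Δ {carrier A})
      e-arr : ∀ {A} → HEq (!-obj A) K-obj (arr (L'.e {A})) (e {carrier A})
      m-arr : ∀ {A B} →
        HEq (trans (⊗-obj (L'.!₀ A) (L'.!₀ B)) (cong₂ _⊗₀_ (!-obj A) (!-obj B)))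
            (trans (!-obj (A L'.⊗₀ B)) (cong !₀ (⊗-obj A B)))
            (arr (L'.m {A} {B})) (m {carrier A} {carrier B})
      mK-arr : HEq K-obj (trans (!-obj L'.K) (cong !₀ K-obj)) (arr L'.mK) mK

module Submission where

-- Every piece of structure on 𝕏^T has the same carriers and the same maps
-- as in 𝕏, so it suffices to check that the structure maps of 𝕏 are
-- algebra morphisms.  For ⊗ and K this is what the comonoidal
-- structure n, n_K is for.  For ⊸, the Hopf condition makes
-- ω = (1 ⊗ a) ∘ n : T(X ⊗ A) → TX ⊗ A invertible for every algebra (A, a),
-- and A ⊸ B carries the transpose of b ∘ T(ev) ∘ ω⁻¹.  For !, the algebra
-- !A carries !a ∘ λ; δ, ε, m, m_K are algebra maps by the axioms of λ, while
-- for Δ and e one first shows that λ is compatible with the comonoid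
-- structure.  That holds because a map into K, or into !B ⊗ !C, which is
-- compatible with a coalgebra structure W is determined by its counit, or
-- by its two projections: m ∘ (δ ⊗ δ) exhibits !B ⊗ !C as a retract of the
-- cofree coalgebra !(!B ⊗ !C).

open import Defs
open import Level using (Level)
open import Data.Product using (Σ; _,_)
open import Relation.Binary.Bundles using (Setoid)
open import Relation.Binary.PropositionalEquality using (refl)
import Relation.Binary.Reasoning.Setoid as SetoidReasoning

module HomReasoning {o h r : Level} (𝕏 : Category o h r) where
  open Category 𝕏

  hom-setoid : Obj → Obj → Setoid h r
  hom-setoid A B = record { Carrier = Hom A B ; _≈_ = _≈_ ; isEquivalence = equiv }

  module _ {A B : Obj} where
    open SetoidReasoning (hom-setoid A B) public using (begin_; _∎; step-≈-⟩; step-≈-⟨)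

  ∘-resp-≈ˡ : ∀ {A B C} {f f' : Hom B C} {g : Hom A B} → f ≈ f' → f ∘ g ≈ f' ∘ g
  ∘-resp-≈ˡ p = ∘-resp-≈ p Eq.refl

  ∘-resp-≈ʳ : ∀ {A B C} {f : Hom B C} {g g' : Hom A B} → g ≈ g' → f ∘ g ≈ f ∘ g'
  ∘-resp-≈ʳ p = ∘-resp-≈ Eq.refl p

  sym-assoc : ∀ {A B C D} {f : Hom A B} {g : Hom B C} {k : Hom C D} →
              k ∘ (g ∘ f) ≈ (k ∘ g) ∘ f
  sym-assoc = Eq.sym assoc

  pullˡ : ∀ {A B C D} {g : Hom C D} {f : Hom B C} {k : Hom B D} {x : Hom A B} →
          g ∘ f ≈ k → g ∘ (f ∘ x) ≈ k ∘ x
  pullˡ p = Eq.trans sym-assoc (∘-resp-≈ˡ p)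

  extendʳ : ∀ {A B B' C D} {g : Hom C D} {f : Hom B C} {k : Hom B' D} {l : Hom B B'}
            {x : Hom A B} → g ∘ f ≈ k ∘ l → g ∘ (f ∘ x) ≈ k ∘ (l ∘ x)
  extendʳ p = Eq.trans (pullˡ p) assoc

  module _ {A B : Obj} {f : Hom A B} (i : IsIso f) where
    open IsIso i

    inv∘f∘-cancel : ∀ {C} {x : Hom C A} → inv ∘ (f ∘ x) ≈ x
    inv∘f∘-cancel = Eq.trans (pullˡ isoˡ) identityˡ

    f∘inv∘-cancel : ∀ {C} {x : Hom C B} → f ∘ (inv ∘ x) ≈ x
    f∘inv∘-cancel = Eq.trans (pullˡ isoʳ) identityˡ

    ∘f∘inv-cancel : ∀ {C} {x : Hom B C} → (x ∘ f) ∘ inv ≈ x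
    ∘f∘inv-cancel = Eq.trans assoc (Eq.trans (∘-resp-≈ʳ isoʳ) identityʳ)

    move-invˡ : ∀ {C} {x : Hom C A} {y : Hom C B} → f ∘ x ≈ y → x ≈ inv ∘ y
    move-invˡ p = Eq.trans (Eq.sym inv∘f∘-cancel) (∘-resp-≈ʳ p)

    move-invʳ : ∀ {C} {x : Hom B C} {y : Hom A C} → x ∘ f ≈ y → x ≈ y ∘ inv
    move-invʳ p = Eq.trans (Eq.sym ∘f∘inv-cancel) (∘-resp-≈ˡ p)

    iso-monic : ∀ {C} {x y : Hom C A} → f ∘ x ≈ f ∘ y → x ≈ y
    iso-monic p = Eq.trans (move-invˡ p) inv∘f∘-cancel

    iso-epic : ∀ {C} {x y : Hom B C} → x ∘ f ≈ y ∘ f → x ≈ y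
    iso-epic p = Eq.trans (move-invʳ p) ∘f∘inv-cancel

  conjugate-inv : ∀ {A B C D} {f : Hom C D} {f' : Hom A B} {x : Hom A C} {y : Hom B D}
    (i : IsIso f) (j : IsIso f') → f ∘ x ≈ y ∘ f' → x ∘ IsIso.inv j ≈ IsIso.inv i ∘ y
  conjugate-inv i j p =
    Eq.trans (Eq.sym (inv∘f∘-cancel i)) (∘-resp-≈ʳ (Eq.trans (pullˡ p) (∘f∘inv-cancel j)))

module MonoidalReasoning {o h r : Level} (𝕏 : Category o h r) (M : SymmetricMonoidal 𝕏) where
  open Category 𝕏
  open SymmetricMonoidal M
  open HomReasoning 𝕏

  infixr 4 _⟩⊗⟨_
  _⟩⊗⟨_ : ∀ {A B C D} {f f' : Hom A B} {g g' : Hom C D} → f ≈ f' → g ≈ g' → f ⊗₁ g ≈ f' ⊗₁ g'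
  _⟩⊗⟨_ = ⊗-resp-≈

  ⊗-merge : ∀ {A B C A' B' C'} {f : Hom A B} {g : Hom B C} {f' : Hom A' B'} {g' : Hom B' C'} →
            (g ⊗₁ g') ∘ (f ⊗₁ f') ≈ (g ∘ f) ⊗₁ (g' ∘ f')
  ⊗-merge = Eq.sym ⊗-homomorphism

  id-slide : ∀ {A B} {f : Hom A B} → id ∘ f ≈ f ∘ id
  id-slide = Eq.trans identityˡ (Eq.sym identityʳ)

  ⊗-squareʳ : ∀ {A A' X X' Y Y'} {a : Hom A A'} {x : Hom X X'} {f : Hom X' Y'} {g : Hom X Y}
              {y : Hom Y Y'} → f ∘ x ≈ y ∘ g → (id ⊗₁ f) ∘ (a ⊗₁ x) ≈ (a ⊗₁ y) ∘ (id ⊗₁ g)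
  ⊗-squareʳ p = Eq.trans ⊗-merge (Eq.trans (id-slide ⟩⊗⟨ p) ⊗-homomorphism)

  ⊗-squareˡ : ∀ {A A' X X' Y Y'} {a : Hom A A'} {x : Hom X X'} {f : Hom X' Y'} {g : Hom X Y}
              {y : Hom Y Y'} → f ∘ x ≈ y ∘ g → (f ⊗₁ id) ∘ (x ⊗₁ a) ≈ (y ⊗₁ a) ∘ (g ⊗₁ id)
  ⊗-squareˡ p = Eq.trans ⊗-merge (Eq.trans (p ⟩⊗⟨ id-slide) ⊗-homomorphism)

  serialize₁₂ : ∀ {A B C D} {f : Hom A B} {g : Hom C D} → f ⊗₁ g ≈ (f ⊗₁ id) ∘ (id ⊗₁ g)
  serialize₁₂ = Eq.trans (Eq.sym identityʳ ⟩⊗⟨ Eq.sym identityˡ) ⊗-homomorphism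

  serialize₂₁ : ∀ {A B C D} {f : Hom A B} {g : Hom C D} → f ⊗₁ g ≈ (id ⊗₁ g) ∘ (f ⊗₁ id)
  serialize₂₁ = Eq.trans (Eq.sym identityˡ ⟩⊗⟨ Eq.sym identityʳ) ⊗-homomorphism

  id⊗-merge₃ : ∀ {A B C D E F} {a : Hom D E} {b : Hom C D} {c : Hom B C} {x : Hom F (A ⊗₀ B)} →
    (id ⊗₁ a) ∘ ((id ⊗₁ b) ∘ ((id ⊗₁ c) ∘ x)) ≈ (id {A} ⊗₁ (a ∘ (b ∘ c))) ∘ x
  id⊗-merge₃ = Eq.trans (∘-resp-≈ʳ (pullˡ (Eq.trans ⊗-merge (identityˡ ⟩⊗⟨ Eq.refl))))
                        (pullˡ (Eq.trans ⊗-merge (identityˡ ⟩⊗⟨ Eq.refl)))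

  K⊗-injective : ∀ {A B} {f g : Hom A B} → id {K} ⊗₁ f ≈ id ⊗₁ g → f ≈ g
  K⊗-injective p = iso-epic ℓ-iso (Eq.trans (Eq.sym ℓ-natural) (Eq.trans (∘-resp-≈ʳ p) ℓ-natural))

  ⊗K-injective : ∀ {A B} {f g : Hom A B} → f ⊗₁ id {K} ≈ g ⊗₁ id → f ≈ g
  ⊗K-injective p = iso-epic ρ-iso (Eq.trans (Eq.sym ρ-natural) (Eq.trans (∘-resp-≈ʳ p) ρ-natural))

  α⁻¹-natural : ∀ {A B C A' B' C'} {f : Hom A A'} {g : Hom B B'} {k : Hom C C'} →
                α⁻¹ ∘ ((f ⊗₁ g) ⊗₁ k) ≈ (f ⊗₁ (g ⊗₁ k)) ∘ α⁻¹
  α⁻¹-natural = Eq.sym (move-invˡ α-iso (Eq.trans (pullˡ α-natural) (∘f∘inv-cancel α-iso)))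

  kelly-ℓ : ∀ {X Y} → ℓ {X ⊗₀ Y} ≈ (ℓ {X} ⊗₁ id {Y}) ∘ α {K} {X} {Y}
  kelly-ℓ = K⊗-injective (iso-monic α-iso (begin
      α ∘ (id ⊗₁ ℓ)
        ≈⟨ ∘-resp-≈ʳ triangle ⟨
      α ∘ ((ρ ⊗₁ id) ∘ α)
        ≈⟨ extendʳ (Eq.trans (∘-resp-≈ʳ (Eq.refl ⟩⊗⟨ Eq.sym ⊗-identity)) α-natural) ⟩
      ((ρ ⊗₁ id) ⊗₁ id) ∘ (α ∘ α)
        ≈⟨ ∘-resp-≈ʳ pentagon ⟩
      ((ρ ⊗₁ id) ⊗₁ id) ∘ ((α ⊗₁ id) ∘ (α ∘ (id ⊗₁ α)))
        ≈⟨ pullˡ (Eq.trans ⊗-merge (triangle ⟩⊗⟨ identityˡ)) ⟩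
      ((id ⊗₁ ℓ) ⊗₁ id) ∘ (α ∘ (id ⊗₁ α))
        ≈⟨ pullˡ (Eq.sym α-natural) ⟩
      (α ∘ (id ⊗₁ (ℓ ⊗₁ id))) ∘ (id ⊗₁ α)
        ≈⟨ Eq.trans assoc (∘-resp-≈ʳ (Eq.trans ⊗-merge (identityˡ ⟩⊗⟨ Eq.refl))) ⟩
      α ∘ (id ⊗₁ ((ℓ ⊗₁ id) ∘ α))
        ∎))

  kelly-ℓ⁻¹ : ∀ {X Y} → ℓ {X ⊗₀ Y} ∘ α⁻¹ {K} {X} {Y} ≈ ℓ {X} ⊗₁ id {Y}
  kelly-ℓ⁻¹ = Eq.sym (move-invʳ α-iso (Eq.sym kelly-ℓ))

  triangle⁻¹ : ∀ {A B} → (id {A} ⊗₁ ℓ {B}) ∘ α⁻¹ ≈ ρ ⊗₁ id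
  triangle⁻¹ = Eq.sym (move-invʳ α-iso triangle)

  σ-iso : ∀ {A B} → IsIso (σ {A} {B})
  σ-iso = record { inv = σ ; isoˡ = σ-involutive ; isoʳ = σ-involutive }

  ℓ∘σ≈ρ : ∀ {A} → ℓ {A} ∘ σ {A} {K} ≈ ρ
  ℓ∘σ≈ρ = Eq.sym (⊗K-injective (iso-monic σ-iso (begin
      σ ∘ (ρ ⊗₁ id)                                 ≈⟨ ∘-resp-≈ʳ triangle⁻¹ ⟨
      σ ∘ ((id ⊗₁ ℓ) ∘ α⁻¹)                         ≈⟨ pullˡ σ-natural ⟩
      ((ℓ ⊗₁ id) ∘ σ) ∘ α⁻¹                         ≈⟨ Eq.trans assoc (∘-resp-≈ˡ (Eq.sym kelly-ℓ⁻¹)) ⟩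
      (ℓ ∘ α⁻¹) ∘ (σ ∘ α⁻¹)                         ≈⟨ Eq.trans assoc (∘-resp-≈ʳ hexagon) ⟩
      ℓ ∘ ((id ⊗₁ σ) ∘ (α⁻¹ ∘ (σ ⊗₁ id)))           ≈⟨ pullˡ ℓ-natural ⟩
      (σ ∘ ℓ) ∘ (α⁻¹ ∘ (σ ⊗₁ id))                   ≈⟨ Eq.trans assoc (∘-resp-≈ʳ (pullˡ kelly-ℓ⁻¹)) ⟩
      σ ∘ ((ℓ ⊗₁ id) ∘ (σ ⊗₁ id))                   ≈⟨ ∘-resp-≈ʳ (Eq.trans ⊗-merge (Eq.refl ⟩⊗⟨ identityˡ)) ⟩
      σ ∘ ((ℓ ∘ σ) ⊗₁ id)                           ∎)))

  ℓK≈ρK : ℓ {K} ≈ ρ {K}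
  ℓK≈ρK = Eq.sym (⊗K-injective (iso-epic α-iso (Eq.trans triangle
            (Eq.trans (iso-monic ℓ-iso ℓ-natural) kelly-ℓ))))

  ρK∘σ≈ρK : ρ {K} ∘ σ {K} {K} ≈ ρ
  ρK∘σ≈ρK = Eq.trans (∘-resp-≈ˡ (Eq.sym ℓ∘σ≈ρ))
              (Eq.trans assoc (Eq.trans (∘-resp-≈ʳ σ-involutive) (Eq.trans identityʳ ℓK≈ρK)))

  τ-natural : ∀ {A B C D A' B' C' D'} {a : Hom A A'} {b : Hom B B'} {c : Hom C C'} {d : Hom D D'} →
    τ ∘ ((a ⊗₁ b) ⊗₁ (c ⊗₁ d)) ≈ ((a ⊗₁ c) ⊗₁ (b ⊗₁ d)) ∘ τ
  τ-natural = begin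
      (α ∘ ((id ⊗₁ α⁻¹) ∘ ((id ⊗₁ (σ ⊗₁ id)) ∘ ((id ⊗₁ α) ∘ α⁻¹)))) ∘ _
        ≈⟨ Eq.trans assoc (∘-resp-≈ʳ (Eq.trans assoc (∘-resp-≈ʳ (Eq.trans assoc
             (∘-resp-≈ʳ (Eq.trans assoc (∘-resp-≈ʳ α⁻¹-natural))))))) ⟩
      α ∘ ((id ⊗₁ α⁻¹) ∘ ((id ⊗₁ (σ ⊗₁ id)) ∘ ((id ⊗₁ α) ∘ (_ ∘ α⁻¹))))
        ≈⟨ ∘-resp-≈ʳ (∘-resp-≈ʳ (∘-resp-≈ʳ (extendʳ (⊗-squareʳ α-natural)))) ⟩
      α ∘ ((id ⊗₁ α⁻¹) ∘ ((id ⊗₁ (σ ⊗₁ id)) ∘ (_ ∘ ((id ⊗₁ α) ∘ α⁻¹))))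
        ≈⟨ ∘-resp-≈ʳ (∘-resp-≈ʳ (extendʳ (⊗-squareʳ (⊗-squareˡ σ-natural)))) ⟩
      α ∘ ((id ⊗₁ α⁻¹) ∘ (_ ∘ ((id ⊗₁ (σ ⊗₁ id)) ∘ ((id ⊗₁ α) ∘ α⁻¹))))
        ≈⟨ ∘-resp-≈ʳ (extendʳ (⊗-squareʳ α⁻¹-natural)) ⟩
      α ∘ (_ ∘ ((id ⊗₁ α⁻¹) ∘ ((id ⊗₁ (σ ⊗₁ id)) ∘ ((id ⊗₁ α) ∘ α⁻¹))))
        ≈⟨ extendʳ α-natural ⟩
      _ ∘ τ
        ∎

  ρ⊗ℓ∘τ : ∀ {P Q} → (ρ {P} ⊗₁ ℓ {Q}) ∘ τ ≈ ρ ⊗₁ ℓ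
  ρ⊗ℓ∘τ {P} {Q} = begin
      (ρ ⊗₁ ℓ) ∘ (α ∘ rest)                               ≈⟨ pullˡ ρ⊗ℓ∘α ⟩
      (id ⊗₁ E) ∘ rest                                    ≈⟨ Eq.trans id⊗-merge₃ (pullˡ (Eq.trans ⊗-merge
                                                               (identityˡ ⟩⊗⟨ Eq.trans assoc (∘-resp-≈ʳ assoc)))) ⟩
      (id ⊗₁ (E ∘ (α⁻¹ ∘ ((σ ⊗₁ id) ∘ α)))) ∘ α⁻¹         ≈⟨ ∘-resp-≈ˡ (Eq.refl ⟩⊗⟨ E-absorbs-σ) ⟩
      (id ⊗₁ E) ∘ α⁻¹                                     ≈⟨ move-invʳ α-iso ρ⊗ℓ∘α ⟨
      ρ ⊗₁ ℓ                                              ∎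
    where
      E : Hom (K ⊗₀ (K ⊗₀ Q)) Q
      E = ℓ ∘ ((ρ ⊗₁ id) ∘ α)
      rest : Hom ((P ⊗₀ K) ⊗₀ (K ⊗₀ Q)) (P ⊗₀ (K ⊗₀ (K ⊗₀ Q)))
      rest = (id ⊗₁ α⁻¹) ∘ ((id ⊗₁ (σ ⊗₁ id)) ∘ ((id ⊗₁ α) ∘ α⁻¹))
      ρ⊗ℓ∘α : (ρ {P} ⊗₁ ℓ {Q}) ∘ α ≈ id ⊗₁ E
      ρ⊗ℓ∘α = begin
          (ρ ⊗₁ ℓ) ∘ α                      ≈⟨ ∘-resp-≈ˡ serialize₂₁ ⟩
          ((id ⊗₁ ℓ) ∘ (ρ ⊗₁ id)) ∘ α       ≈⟨ Eq.trans assoc (∘-resp-≈ʳ triangle) ⟩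
          (id ⊗₁ ℓ) ∘ (id ⊗₁ ℓ)             ≈⟨ Eq.trans ⊗-merge (identityˡ ⟩⊗⟨
                                                 Eq.trans (Eq.sym ℓ-natural) (∘-resp-≈ʳ (Eq.sym triangle))) ⟩
          id ⊗₁ E                           ∎
      E-absorbs-σ : E ∘ (α⁻¹ ∘ ((σ ⊗₁ id) ∘ α)) ≈ E
      E-absorbs-σ = begin
          (ℓ ∘ ((ρ ⊗₁ id) ∘ α)) ∘ (α⁻¹ ∘ ((σ ⊗₁ id) ∘ α))
            ≈⟨ Eq.trans assoc (∘-resp-≈ʳ (Eq.trans assoc
                (∘-resp-≈ʳ (f∘inv∘-cancel α-iso)))) ⟩
          ℓ ∘ ((ρ ⊗₁ id) ∘ ((σ ⊗₁ id) ∘ α))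
            ≈⟨ ∘-resp-≈ʳ (pullˡ (Eq.trans ⊗-merge (ρK∘σ≈ρK ⟩⊗⟨ identityˡ))) ⟩
          E
            ∎

module CoalgebraModalityProperties {o h r : Level} (𝕏 : Category o h r) (M : SymmetricMonoidal 𝕏)
                                   (Ex : MonoidalCoalgebraModality 𝕏 M) where
  open Category 𝕏
  open SymmetricMonoidal M
  open MonoidalCoalgebraModality Ex
  open HomReasoning 𝕏
  open MonoidalReasoning 𝕏 M

  !-merge : ∀ {A B C} {f : Hom A B} {g : Hom B C} → !₁ g ∘ !₁ f ≈ !₁ (g ∘ f)
  !-merge = Eq.sym !-homomorphism

  e-universal : ∀ {D} (x : Hom D K) (W : Hom D (!₀ D)) → mK ∘ x ≈ !₁ x ∘ W → x ≈ e ∘ W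
  e-universal x W p = Eq.trans (Eq.sym (Eq.trans (pullˡ e-mK) identityˡ))
                        (Eq.trans (∘-resp-≈ʳ p) (pullˡ e-natural))

  π₁ : ∀ {B C} → Hom (!₀ B ⊗₀ !₀ C) (!₀ B)
  π₁ = ρ ∘ (id ⊗₁ e)

  π₂ : ∀ {B C} → Hom (!₀ B ⊗₀ !₀ C) (!₀ C)
  π₂ = ℓ ∘ (e ⊗₁ id)

  π₁∘Δ : ∀ {A} → π₁ ∘ Δ {A} ≈ id
  π₁∘Δ = Eq.trans assoc counitʳ

  π₂∘Δ : ∀ {A} → π₂ ∘ Δ {A} ≈ id
  π₂∘Δ = Eq.trans assoc counitˡ

  unpair : ∀ {B C} → Hom (!₀ (!₀ B ⊗₀ !₀ C)) (!₀ B ⊗₀ !₀ C)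
  unpair = (ε ⊗₁ ε) ∘ ((!₁ π₁ ⊗₁ !₁ π₂) ∘ Δ)

  ε-!-mδ : ∀ {B C Z} {p : Hom (!₀ B ⊗₀ !₀ C) Z} → ε ∘ (!₁ p ∘ (m ∘ (δ ⊗₁ δ))) ≈ p
  ε-!-mδ = begin
      ε ∘ (!₁ _ ∘ (m ∘ (δ ⊗₁ δ)))     ≈⟨ pullˡ ε-natural ⟩
      (_ ∘ ε) ∘ (m ∘ (δ ⊗₁ δ))        ≈⟨ Eq.trans assoc (∘-resp-≈ʳ (pullˡ ε-m)) ⟩
      _ ∘ ((ε ⊗₁ ε) ∘ (δ ⊗₁ δ))       ≈⟨ ∘-resp-≈ʳ (Eq.trans ⊗-merge (Eq.trans
                                           (comonad-identityˡ ⟩⊗⟨ comonad-identityˡ) ⊗-identity)) ⟩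
      _ ∘ id                          ≈⟨ identityʳ ⟩
      _                               ∎

  unpair∘mδ : ∀ {B C} → unpair {B} {C} ∘ (m ∘ (δ ⊗₁ δ)) ≈ id
  unpair∘mδ = begin
      ((ε ⊗₁ ε) ∘ ((!₁ π₁ ⊗₁ !₁ π₂) ∘ Δ)) ∘ (m ∘ (δ ⊗₁ δ))
        ≈⟨ Eq.trans assoc (∘-resp-≈ʳ (Eq.trans assoc (∘-resp-≈ʳ (pullˡ Δ-m)))) ⟩
      (ε ⊗₁ ε) ∘ ((!₁ π₁ ⊗₁ !₁ π₂) ∘ (((m ⊗₁ m) ∘ (τ ∘ (Δ ⊗₁ Δ))) ∘ (δ ⊗₁ δ)))
        ≈⟨ ∘-resp-≈ʳ (∘-resp-≈ʳ (Eq.trans assoc (∘-resp-≈ʳ (Eq.trans assoc (∘-resp-≈ʳ Δ⊗Δ∘δ⊗δ))))) ⟩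
      (ε ⊗₁ ε) ∘ ((!₁ π₁ ⊗₁ !₁ π₂) ∘ ((m ⊗₁ m) ∘ (τ ∘ (((δ ⊗₁ δ) ⊗₁ (δ ⊗₁ δ)) ∘ (Δ ⊗₁ Δ)))))
        ≈⟨ ∘-resp-≈ʳ (∘-resp-≈ʳ (∘-resp-≈ʳ (Eq.trans (pullˡ τ-natural) assoc))) ⟩
      (ε ⊗₁ ε) ∘ ((!₁ π₁ ⊗₁ !₁ π₂) ∘ ((m ⊗₁ m) ∘ (((δ ⊗₁ δ) ⊗₁ (δ ⊗₁ δ)) ∘ (τ ∘ (Δ ⊗₁ Δ)))))
        ≈⟨ ∘-resp-≈ʳ (∘-resp-≈ʳ (pullˡ ⊗-merge)) ⟩
      (ε ⊗₁ ε) ∘ ((!₁ π₁ ⊗₁ !₁ π₂) ∘ ((m ∘ (δ ⊗₁ δ)) ⊗₁ (m ∘ (δ ⊗₁ δ))) ∘ (τ ∘ (Δ ⊗₁ Δ)))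
        ≈⟨ ∘-resp-≈ʳ (pullˡ ⊗-merge) ⟩
      (ε ⊗₁ ε) ∘ ((!₁ π₁ ∘ (m ∘ (δ ⊗₁ δ))) ⊗₁ (!₁ π₂ ∘ (m ∘ (δ ⊗₁ δ)))) ∘ (τ ∘ (Δ ⊗₁ Δ))
        ≈⟨ pullˡ (Eq.trans ⊗-merge (ε-!-mδ ⟩⊗⟨ ε-!-mδ)) ⟩
      (π₁ ⊗₁ π₂) ∘ (τ ∘ (Δ ⊗₁ Δ))
        ≈⟨ ∘-resp-≈ˡ ⊗-homomorphism ⟩
      ((ρ ⊗₁ ℓ) ∘ ((id ⊗₁ e) ⊗₁ (e ⊗₁ id))) ∘ (τ ∘ (Δ ⊗₁ Δ))
        ≈⟨ Eq.trans assoc (∘-resp-≈ʳ (Eq.trans (pullˡ (Eq.sym τ-natural)) assoc)) ⟩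
      (ρ ⊗₁ ℓ) ∘ (τ ∘ (((id ⊗₁ e) ⊗₁ (e ⊗₁ id)) ∘ (Δ ⊗₁ Δ)))
        ≈⟨ pullˡ ρ⊗ℓ∘τ ⟩
      (ρ ⊗₁ ℓ) ∘ (((id ⊗₁ e) ⊗₁ (e ⊗₁ id)) ∘ (Δ ⊗₁ Δ))
        ≈⟨ ∘-resp-≈ʳ ⊗-merge ⟩
      (ρ ⊗₁ ℓ) ∘ (((id ⊗₁ e) ∘ Δ) ⊗₁ ((e ⊗₁ id) ∘ Δ))
        ≈⟨ Eq.trans ⊗-merge (Eq.trans (counitʳ ⟩⊗⟨ counitˡ) ⊗-identity) ⟩
      id
        ∎
    where
      Δ⊗Δ∘δ⊗δ : ∀ {B C} → (Δ ⊗₁ Δ) ∘ (δ {B} ⊗₁ δ {C}) ≈ ((δ ⊗₁ δ) ⊗₁ (δ ⊗₁ δ)) ∘ (Δ ⊗₁ Δ)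
      Δ⊗Δ∘δ⊗δ = Eq.trans ⊗-merge (Eq.trans (δ-Δ ⟩⊗⟨ δ-Δ) ⊗-homomorphism)

  unpair∘! : ∀ {D B C} (X : Hom D (!₀ B ⊗₀ !₀ C)) →
             unpair ∘ !₁ X ≈ ((π₁ ∘ (X ∘ ε)) ⊗₁ (π₂ ∘ (X ∘ ε))) ∘ Δ
  unpair∘! {D} {B} {C} X = begin
      ((ε ⊗₁ ε) ∘ ((!₁ π₁ ⊗₁ !₁ π₂) ∘ Δ)) ∘ !₁ X
        ≈⟨ Eq.trans assoc (∘-resp-≈ʳ (Eq.trans assoc (∘-resp-≈ʳ Δ-natural))) ⟩
      (ε ⊗₁ ε) ∘ ((!₁ π₁ ⊗₁ !₁ π₂) ∘ ((!₁ X ⊗₁ !₁ X) ∘ Δ))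
        ≈⟨ ∘-resp-≈ʳ (pullˡ ⊗-merge) ⟩
      (ε ⊗₁ ε) ∘ ((!₁ π₁ ∘ !₁ X) ⊗₁ (!₁ π₂ ∘ !₁ X)) ∘ Δ
        ≈⟨ pullˡ (Eq.trans ⊗-merge (ε-!-! ⟩⊗⟨ ε-!-!)) ⟩
      ((π₁ ∘ (X ∘ ε)) ⊗₁ (π₂ ∘ (X ∘ ε))) ∘ Δ
        ∎
    where
      ε-!-! : ∀ {Z} {q : Hom (!₀ B ⊗₀ !₀ C) Z} → ε ∘ (!₁ q ∘ !₁ X) ≈ q ∘ (X ∘ ε)
      ε-!-! = Eq.trans (∘-resp-≈ʳ !-merge) (Eq.trans ε-natural assoc)

  !⊗!-ext : ∀ {D B C} (X Y : Hom D (!₀ B ⊗₀ !₀ C)) (W : Hom D (!₀ D)) →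
    m ∘ ((δ ⊗₁ δ) ∘ X) ≈ !₁ X ∘ W → m ∘ ((δ ⊗₁ δ) ∘ Y) ≈ !₁ Y ∘ W →
    π₁ ∘ X ≈ π₁ ∘ Y → π₂ ∘ X ≈ π₂ ∘ Y → X ≈ Y
  !⊗!-ext X Y W hX hY e₁ e₂ = begin
      X                                                       ≈⟨ Eq.trans (pullˡ unpair∘mδ) identityˡ ⟨
      unpair ∘ ((m ∘ (δ ⊗₁ δ)) ∘ X)                           ≈⟨ ∘-resp-≈ʳ (Eq.trans assoc hX) ⟩
      unpair ∘ (!₁ X ∘ W)                                     ≈⟨ pullˡ (unpair∘! X) ⟩
      (((π₁ ∘ (X ∘ ε)) ⊗₁ (π₂ ∘ (X ∘ ε))) ∘ Δ) ∘ W           ≈⟨ ∘-resp-≈ˡ (∘-resp-≈ˡ (∘ε-cong e₁ ⟩⊗⟨ ∘ε-cong e₂)) ⟩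
      (((π₁ ∘ (Y ∘ ε)) ⊗₁ (π₂ ∘ (Y ∘ ε))) ∘ Δ) ∘ W           ≈⟨ pullˡ (unpair∘! Y) ⟨
      unpair ∘ (!₁ Y ∘ W)                                     ≈⟨ ∘-resp-≈ʳ (Eq.trans assoc hY) ⟨
      unpair ∘ ((m ∘ (δ ⊗₁ δ)) ∘ Y)                           ≈⟨ Eq.trans (pullˡ unpair∘mδ) identityˡ ⟩
      Y                                                       ∎
    where
      ∘ε-cong : ∀ {E F} {π : Hom E F} {x y : Hom _ E} → π ∘ x ≈ π ∘ y → π ∘ (x ∘ ε) ≈ π ∘ (y ∘ ε)
      ∘ε-cong p = Eq.trans sym-assoc (Eq.trans (∘-resp-≈ˡ p) assoc)

module MonadProperties {o h r : Level} {𝕏 : Category o h r} (𝕋 : Monad 𝕏) where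
  open Category 𝕏
  open Monad 𝕋
  open HomReasoning 𝕏
  open Algebra
  open AlgHom

  T-merge : ∀ {A B C} {f : Hom A B} {g : Hom B C} → T₁ g ∘ T₁ f ≈ T₁ (g ∘ f)
  T-merge = Eq.sym T-homomorphism

  T-≈id : ∀ {A} {f : Hom A A} → f ≈ id → T₁ f ≈ id
  T-≈id p = Eq.trans (T-resp-≈ p) T-identity

  forgetful-reflects-iso : ∀ {A B} (f : AlgHom 𝕏 𝕋 A B) → IsIso (arr f) → Category.IsIso (EM 𝕏 𝕋) f
  forgetful-reflects-iso {A} {B} f i = record
    { inv = record { arr = inv ; commutes = inv-commutes }
    ; isoˡ = isoˡ
    ; isoʳ = isoʳ
    }
    where
      open IsIso i
      inv-commutes : inv ∘ act B ≈ act A ∘ T₁ inv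
      inv-commutes = begin
          inv ∘ act B
            ≈⟨ ∘-resp-≈ʳ (Eq.trans (∘-resp-≈ʳ (Eq.trans T-merge (T-≈id isoʳ))) identityʳ) ⟨
          inv ∘ (act B ∘ (T₁ (arr f) ∘ T₁ inv))
            ≈⟨ ∘-resp-≈ʳ (Eq.trans sym-assoc (∘-resp-≈ˡ (Eq.sym (commutes f)))) ⟩
          inv ∘ ((arr f ∘ act A) ∘ T₁ inv)
            ≈⟨ Eq.trans (∘-resp-≈ʳ assoc) (inv∘f∘-cancel i) ⟩
          act A ∘ T₁ inv
            ∎

module EMMonoidal {o h r : Level} {𝕏 : Category o h r} (M : SymmetricMonoidal 𝕏)
                  (𝕋 : SymmetricComonoidalMonad 𝕏 M) where
  open Category 𝕏
  open SymmetricMonoidal M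
  open SymmetricComonoidalMonad 𝕋
  open HomReasoning 𝕏
  open MonoidalReasoning 𝕏 M
  open MonadProperties monad
  open Algebra
  open AlgHom

  infixr 10 _⊗ᴬ_ _⊗ᴴ_

  _⊗ᴬ_ : Algebra 𝕏 monad → Algebra 𝕏 monad → Algebra 𝕏 monad
  X ⊗ᴬ Y = record
    { carrier = carrier X ⊗₀ carrier Y
    ; act = (a ⊗₁ b) ∘ n
    ; act-η = Eq.trans assoc (Eq.trans (∘-resp-≈ʳ n-η)
                (Eq.trans ⊗-merge (Eq.trans (act-η X ⟩⊗⟨ act-η Y) ⊗-identity)))
    ; act-μ = begin
        ((a ⊗₁ b) ∘ n) ∘ T₁ ((a ⊗₁ b) ∘ n)            ≈⟨ Eq.trans assoc (∘-resp-≈ʳ (∘-resp-≈ʳ T-homomorphism)) ⟩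
        (a ⊗₁ b) ∘ (n ∘ (T₁ (a ⊗₁ b) ∘ T₁ n))         ≈⟨ ∘-resp-≈ʳ (pullˡ n-natural) ⟩
        (a ⊗₁ b) ∘ ((T₁ a ⊗₁ T₁ b) ∘ n) ∘ T₁ n        ≈⟨ Eq.trans (∘-resp-≈ʳ assoc) (pullˡ ⊗-merge) ⟩
        ((a ∘ T₁ a) ⊗₁ (b ∘ T₁ b)) ∘ (n ∘ T₁ n)       ≈⟨ ∘-resp-≈ˡ (act-μ X ⟩⊗⟨ act-μ Y) ⟩
        ((a ∘ μ) ⊗₁ (b ∘ μ)) ∘ (n ∘ T₁ n)             ≈⟨ Eq.trans (∘-resp-≈ˡ ⊗-homomorphism) assoc ⟩
        (a ⊗₁ b) ∘ ((μ ⊗₁ μ) ∘ (n ∘ T₁ n))            ≈⟨ ∘-resp-≈ʳ n-μ ⟨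
        (a ⊗₁ b) ∘ (n ∘ μ)                            ≈⟨ sym-assoc ⟩
        ((a ⊗₁ b) ∘ n) ∘ μ                            ∎
    }
    where
      a = act X
      b = act Y

  _⊗ᴴ_ : ∀ {A B C D} → AlgHom 𝕏 monad A B → AlgHom 𝕏 monad C D →
         AlgHom 𝕏 monad (A ⊗ᴬ C) (B ⊗ᴬ D)
  _⊗ᴴ_ {A} {B} {C} {D} f g = record
    { arr = arr f ⊗₁ arr g
    ; commutes = begin
        (arr f ⊗₁ arr g) ∘ ((act A ⊗₁ act C) ∘ n)
          ≈⟨ pullˡ (Eq.trans ⊗-merge (commutes f ⟩⊗⟨ commutes g)) ⟩
        ((act B ∘ T₁ (arr f)) ⊗₁ (act D ∘ T₁ (arr g))) ∘ n
          ≈⟨ Eq.trans (∘-resp-≈ˡ ⊗-homomorphism) assoc ⟩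
        (act B ⊗₁ act D) ∘ ((T₁ (arr f) ⊗₁ T₁ (arr g)) ∘ n)
          ≈⟨ Eq.trans (∘-resp-≈ʳ (Eq.sym n-natural)) sym-assoc ⟩
        ((act B ⊗₁ act D) ∘ n) ∘ T₁ (arr f ⊗₁ arr g)
          ∎
    }

  Kᴬ : Algebra 𝕏 monad
  Kᴬ = record { carrier = K ; act = nK ; act-η = nK-η ; act-μ = Eq.sym nK-μ }

  αᴴ : ∀ {A B C} → AlgHom 𝕏 monad (A ⊗ᴬ (B ⊗ᴬ C)) ((A ⊗ᴬ B) ⊗ᴬ C)
  αᴴ {A} {B} {C} = record
    { arr = α
    ; commutes = begin
        α ∘ ((a ⊗₁ ((b ⊗₁ c) ∘ n)) ∘ n)
          ≈⟨ ∘-resp-≈ʳ (Eq.trans (∘-resp-≈ˡ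
              (Eq.trans (Eq.sym identityʳ ⟩⊗⟨ Eq.refl) ⊗-homomorphism)) assoc) ⟩
        α ∘ ((a ⊗₁ (b ⊗₁ c)) ∘ ((id ⊗₁ n) ∘ n))
          ≈⟨ extendʳ α-natural ⟩
        ((a ⊗₁ b) ⊗₁ c) ∘ (α ∘ ((id ⊗₁ n) ∘ n))
          ≈⟨ ∘-resp-≈ʳ n-assoc ⟨
        ((a ⊗₁ b) ⊗₁ c) ∘ ((n ⊗₁ id) ∘ (n ∘ T₁ α))
          ≈⟨ Eq.trans sym-assoc (∘-resp-≈ˡ (Eq.trans ⊗-merge (Eq.refl ⟩⊗⟨ identityʳ))) ⟩
        (((a ⊗₁ b) ∘ n) ⊗₁ c) ∘ (n ∘ T₁ α)
          ≈⟨ sym-assoc ⟩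
        ((((a ⊗₁ b) ∘ n) ⊗₁ c) ∘ n) ∘ T₁ α
          ∎
    }
    where
      a = act A
      b = act B
      c = act C

  ℓᴴ : ∀ {A} → AlgHom 𝕏 monad (Kᴬ ⊗ᴬ A) A
  ℓᴴ = record
    { arr = ℓ
    ; commutes = Eq.trans (∘-resp-≈ʳ (Eq.trans (∘-resp-≈ˡ serialize₂₁) assoc))
                   (Eq.trans (extendʳ ℓ-natural) (∘-resp-≈ʳ n-unitˡ))
    }

  ρᴴ : ∀ {A} → AlgHom 𝕏 monad (A ⊗ᴬ Kᴬ) A
  ρᴴ = record
    { arr = ρ
    ; commutes = Eq.trans (∘-resp-≈ʳ (Eq.trans (∘-resp-≈ˡ serialize₁₂) assoc))
                   (Eq.trans (extendʳ ρ-natural) (∘-resp-≈ʳ n-unitʳ))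
    }

  σᴴ : ∀ {A B} → AlgHom 𝕏 monad (A ⊗ᴬ B) (B ⊗ᴬ A)
  σᴴ = record
    { arr = σ
    ; commutes = Eq.trans (extendʳ σ-natural) (Eq.trans (∘-resp-≈ʳ n-symmetric) sym-assoc)
    }

  monoidalᴱ : SymmetricMonoidal (EM 𝕏 monad)
  monoidalᴱ = record
    { _⊗₀_ = _⊗ᴬ_
    ; _⊗₁_ = _⊗ᴴ_
    ; K = Kᴬ
    ; ⊗-identity = ⊗-identity
    ; ⊗-homomorphism = ⊗-homomorphism
    ; ⊗-resp-≈ = ⊗-resp-≈
    ; α = αᴴ
    ; α-iso = forgetful-reflects-iso αᴴ α-iso
    ; α-natural = α-natural
    ; ℓ = ℓᴴ
    ; ℓ-iso = forgetful-reflects-iso ℓᴴ ℓ-iso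
    ; ℓ-natural = ℓ-natural
    ; ρ = ρᴴ
    ; ρ-iso = forgetful-reflects-iso ρᴴ ρ-iso
    ; ρ-natural = ρ-natural
    ; σ = σᴴ
    ; σ-natural = σ-natural
    ; σ-involutive = σ-involutive
    ; pentagon = pentagon
    ; triangle = triangle
    ; hexagon = hexagon
    }

module EMClosed {o h r : Level} {𝕏 : Category o h r} (M : SymmetricMonoidal 𝕏) (C : Closed 𝕏 M)
                (𝕋 : SymmetricComonoidalMonad 𝕏 M) (hopf : IsHopf 𝕏 M 𝕋) where
  open Category 𝕏
  open SymmetricMonoidal M
  open Closed C
  open SymmetricComonoidalMonad 𝕋
  open IsHopf hopf
  open HomReasoning 𝕏
  open MonoidalReasoning 𝕏 M
  open MonadProperties monad
  open EMMonoidal M 𝕋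
  open Algebra
  open AlgHom

  hˡ⁻¹ : ∀ {X A} → Hom (T₀ X ⊗₀ T₀ A) (T₀ (X ⊗₀ T₀ A))
  hˡ⁻¹ = IsIso.inv hˡ-iso

  id∘T₁id : ∀ {X} → id ∘ T₁ (id {X}) ≈ id
  id∘T₁id = Eq.trans identityˡ T-identity

  hˡ-η : ∀ {X A} → hˡ {X} {A} ∘ T₁ (id ⊗₁ η) ≈ n
  hˡ-η = begin
      ((id ⊗₁ μ) ∘ n) ∘ T₁ (id ⊗₁ η)
        ≈⟨ Eq.trans assoc (∘-resp-≈ʳ n-natural) ⟩
      (id ⊗₁ μ) ∘ ((T₁ id ⊗₁ T₁ η) ∘ n)
        ≈⟨ pullˡ (Eq.trans ⊗-merge (Eq.trans (id∘T₁id ⟩⊗⟨ monad-identityˡ) ⊗-identity)) ⟩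
      id ∘ n
        ≈⟨ identityˡ ⟩
      n
        ∎

  hˡ⁻¹-n : ∀ {X A} → hˡ⁻¹ {X} {A} ∘ n ≈ T₁ (id ⊗₁ η)
  hˡ⁻¹-n = Eq.sym (move-invˡ hˡ-iso hˡ-η)

  hˡ-commute : ∀ {X A A'} {k k' : Hom (T₀ A') (T₀ A)} → μ ∘ T₁ k ≈ k' ∘ μ →
               hˡ {X} {A} ∘ T₁ (id ⊗₁ k) ≈ (id ⊗₁ k') ∘ hˡ {X} {A'}
  hˡ-commute {k = k} {k'} p = begin
      ((id ⊗₁ μ) ∘ n) ∘ T₁ (id ⊗₁ k)       ≈⟨ Eq.trans assoc (∘-resp-≈ʳ n-natural) ⟩
      (id ⊗₁ μ) ∘ ((T₁ id ⊗₁ T₁ k) ∘ n)    ≈⟨ pullˡ (Eq.trans ⊗-merge (Eq.trans (id∘T₁id ⟩⊗⟨ p)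
                                                (Eq.trans (Eq.sym identityˡ ⟩⊗⟨ Eq.refl) ⊗-homomorphism))) ⟩
      ((id ⊗₁ k') ∘ (id ⊗₁ μ)) ∘ n         ≈⟨ assoc ⟩
      (id ⊗₁ k') ∘ ((id ⊗₁ μ) ∘ n)         ∎

  hˡ⁻¹-commute : ∀ {X A A'} {k k' : Hom (T₀ A') (T₀ A)} → μ ∘ T₁ k ≈ k' ∘ μ →
                 T₁ (id ⊗₁ k) ∘ hˡ⁻¹ {X} {A'} ≈ hˡ⁻¹ {X} {A} ∘ (id ⊗₁ k')
  hˡ⁻¹-commute p = conjugate-inv hˡ-iso hˡ-iso (hˡ-commute p)

  module Fusion (A : Algebra 𝕏 monad) where
    a = act A

    ω : ∀ {X} → Hom (T₀ (X ⊗₀ carrier A)) (T₀ X ⊗₀ carrier A)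
    ω = (id ⊗₁ a) ∘ n

    ω⁻¹ : ∀ {X} → Hom (T₀ X ⊗₀ carrier A) (T₀ (X ⊗₀ carrier A))
    ω⁻¹ = T₁ (id ⊗₁ a) ∘ (hˡ⁻¹ ∘ (id ⊗₁ η))

    ω∘ω⁻¹ : ∀ {X} → ω {X} ∘ ω⁻¹ ≈ id
    ω∘ω⁻¹ = begin
        ((id ⊗₁ a) ∘ n) ∘ (T₁ (id ⊗₁ a) ∘ (hˡ⁻¹ ∘ (id ⊗₁ η)))
          ≈⟨ Eq.trans assoc (∘-resp-≈ʳ (extendʳ n-natural)) ⟩
        (id ⊗₁ a) ∘ ((T₁ id ⊗₁ T₁ a) ∘ (n ∘ (hˡ⁻¹ ∘ (id ⊗₁ η))))
          ≈⟨ extendʳ (Eq.trans ⊗-merge (Eq.trans (Eq.trans id∘T₁id (Eq.sym identityˡ) ⟩⊗⟨ act-μ A)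
               ⊗-homomorphism)) ⟩
        (id ⊗₁ a) ∘ ((id ⊗₁ μ) ∘ (n ∘ (hˡ⁻¹ ∘ (id ⊗₁ η))))
          ≈⟨ ∘-resp-≈ʳ (Eq.trans sym-assoc (f∘inv∘-cancel hˡ-iso)) ⟩
        (id ⊗₁ a) ∘ (id ⊗₁ η)
          ≈⟨ Eq.trans ⊗-merge (Eq.trans (identityˡ ⟩⊗⟨ act-η A) ⊗-identity) ⟩
        id
          ∎

    ω⁻¹∘ω : ∀ {X} → ω⁻¹ {X} ∘ ω ≈ id
    ω⁻¹∘ω = begin
        (T₁ (id ⊗₁ a) ∘ (hˡ⁻¹ ∘ (id ⊗₁ η))) ∘ ((id ⊗₁ a) ∘ n)
          ≈⟨ Eq.trans assoc (∘-resp-≈ʳ (Eq.trans assoc (∘-resp-≈ʳ (pullˡ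
               (Eq.trans ⊗-merge (Eq.trans (Eq.refl ⟩⊗⟨ η-natural) ⊗-homomorphism)))))) ⟩
        T₁ (id ⊗₁ a) ∘ (hˡ⁻¹ ∘ (((id ⊗₁ T₁ a) ∘ (id ⊗₁ η)) ∘ n))
          ≈⟨ ∘-resp-≈ʳ (∘-resp-≈ʳ assoc) ⟩
        T₁ (id ⊗₁ a) ∘ (hˡ⁻¹ ∘ ((id ⊗₁ T₁ a) ∘ ((id ⊗₁ η) ∘ n)))
          ≈⟨ ∘-resp-≈ʳ (extendʳ (Eq.sym (hˡ⁻¹-commute μ-natural))) ⟩
        T₁ (id ⊗₁ a) ∘ (T₁ (id ⊗₁ T₁ a) ∘ (hˡ⁻¹ ∘ ((id ⊗₁ η) ∘ n)))
          ≈⟨ extendʳ (Eq.trans T-merge (Eq.trans (T-resp-≈ (Eq.trans ⊗-merge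
               (Eq.trans (Eq.refl ⟩⊗⟨ act-μ A) ⊗-homomorphism))) T-homomorphism)) ⟩
        T₁ (id ⊗₁ a) ∘ (T₁ (id ⊗₁ μ) ∘ (hˡ⁻¹ ∘ ((id ⊗₁ η) ∘ n)))
          ≈⟨ ∘-resp-≈ʳ (extendʳ (hˡ⁻¹-commute monad-assoc)) ⟩
        T₁ (id ⊗₁ a) ∘ (hˡ⁻¹ ∘ ((id ⊗₁ μ) ∘ ((id ⊗₁ η) ∘ n)))
          ≈⟨ ∘-resp-≈ʳ (∘-resp-≈ʳ (Eq.trans (pullˡ (Eq.trans ⊗-merge
               (Eq.trans (identityˡ ⟩⊗⟨ monad-identityʳ) ⊗-identity))) identityˡ)) ⟩
        T₁ (id ⊗₁ a) ∘ (hˡ⁻¹ ∘ n)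
          ≈⟨ ∘-resp-≈ʳ hˡ⁻¹-n ⟩
        T₁ (id ⊗₁ a) ∘ T₁ (id ⊗₁ η)
          ≈⟨ Eq.trans T-merge (T-≈id (Eq.trans ⊗-merge (Eq.trans (identityˡ ⟩⊗⟨ act-η A) ⊗-identity))) ⟩
        id
          ∎

    ω-iso : ∀ {X} → IsIso (ω {X})
    ω-iso = record { inv = ω⁻¹ ; isoˡ = ω⁻¹∘ω ; isoʳ = ω∘ω⁻¹ }

    ω-natural : ∀ {X X'} {f : Hom X X'} → ω ∘ T₁ (f ⊗₁ id) ≈ (T₁ f ⊗₁ id) ∘ ω
    ω-natural = begin
        ((id ⊗₁ a) ∘ n) ∘ T₁ (_ ⊗₁ id)       ≈⟨ Eq.trans assoc (∘-resp-≈ʳ n-natural) ⟩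
        (id ⊗₁ a) ∘ ((T₁ _ ⊗₁ T₁ id) ∘ n)    ≈⟨ pullˡ (Eq.trans ⊗-merge (Eq.trans (id-slide ⟩⊗⟨
                                                  Eq.trans (∘-resp-≈ʳ T-identity) (Eq.sym id-slide)) ⊗-homomorphism)) ⟩
        ((T₁ _ ⊗₁ id) ∘ (id ⊗₁ a)) ∘ n       ≈⟨ assoc ⟩
        (T₁ _ ⊗₁ id) ∘ ((id ⊗₁ a) ∘ n)       ∎

    ω⁻¹-natural : ∀ {X X'} {f : Hom X X'} → ω⁻¹ ∘ (T₁ f ⊗₁ id) ≈ T₁ (f ⊗₁ id) ∘ ω⁻¹
    ω⁻¹-natural = Eq.sym (conjugate-inv ω-iso ω-iso ω-natural)

    ω⁻¹-η : ∀ {X} → ω⁻¹ {X} ∘ (η ⊗₁ id) ≈ η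
    ω⁻¹-η = Eq.sym (move-invˡ ω-iso (begin
        ((id ⊗₁ a) ∘ n) ∘ η       ≈⟨ Eq.trans assoc (∘-resp-≈ʳ n-η) ⟩
        (id ⊗₁ a) ∘ (η ⊗₁ η)      ≈⟨ Eq.trans ⊗-merge (identityˡ ⟩⊗⟨ act-η A) ⟩
        η ⊗₁ id                   ∎))

    ω-μ : ∀ {X} → ω {X} ∘ μ ≈ (μ ⊗₁ id) ∘ (ω ∘ T₁ ω)
    ω-μ = begin
        ((id ⊗₁ a) ∘ n) ∘ μ
          ≈⟨ Eq.trans assoc (∘-resp-≈ʳ n-μ) ⟩
        (id ⊗₁ a) ∘ ((μ ⊗₁ μ) ∘ (n ∘ T₁ n))
          ≈⟨ pullˡ ⊗-merge ⟩
        ((id ∘ μ) ⊗₁ (a ∘ μ)) ∘ (n ∘ T₁ n)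
          ≈⟨ ∘-resp-≈ˡ (Eq.trans identityˡ (Eq.sym (Eq.trans (∘-resp-≈ʳ id∘T₁id) identityʳ)) ⟩⊗⟨
               Eq.trans (Eq.sym (act-μ A)) (Eq.sym identityˡ)) ⟩
        ((μ ∘ (id ∘ T₁ id)) ⊗₁ (id ∘ (a ∘ T₁ a))) ∘ (n ∘ T₁ n)
          ≈⟨ ∘-resp-≈ˡ (Eq.trans ⊗-homomorphism (∘-resp-≈ʳ ⊗-homomorphism)) ⟩
        ((μ ⊗₁ id) ∘ ((id ⊗₁ a) ∘ (T₁ id ⊗₁ T₁ a))) ∘ (n ∘ T₁ n)
          ≈⟨ Eq.trans assoc (∘-resp-≈ʳ (Eq.trans assoc (∘-resp-≈ʳ (Eq.sym (extendʳ n-natural))))) ⟩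
        (μ ⊗₁ id) ∘ ((id ⊗₁ a) ∘ (n ∘ (T₁ (id ⊗₁ a) ∘ T₁ n)))
          ≈⟨ ∘-resp-≈ʳ (Eq.trans sym-assoc (∘-resp-≈ʳ T-merge)) ⟩
        (μ ⊗₁ id) ∘ (((id ⊗₁ a) ∘ n) ∘ T₁ ((id ⊗₁ a) ∘ n))
          ∎

    ω⁻¹-μ : ∀ {X} → ω⁻¹ {X} ∘ (μ ⊗₁ id) ≈ μ ∘ (T₁ ω⁻¹ ∘ ω⁻¹)
    ω⁻¹-μ = Eq.sym (move-invˡ ω-iso (begin
        ω ∘ (μ ∘ (T₁ ω⁻¹ ∘ ω⁻¹))
          ≈⟨ pullˡ ω-μ ⟩
        ((μ ⊗₁ id) ∘ (ω ∘ T₁ ω)) ∘ (T₁ ω⁻¹ ∘ ω⁻¹)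
          ≈⟨ Eq.trans assoc (∘-resp-≈ʳ (Eq.trans assoc (∘-resp-≈ʳ
               (Eq.trans (pullˡ (Eq.trans T-merge (T-≈id ω∘ω⁻¹))) identityˡ)))) ⟩
        (μ ⊗₁ id) ∘ (ω ∘ ω⁻¹)
          ≈⟨ Eq.trans (∘-resp-≈ʳ ω∘ω⁻¹) identityʳ ⟩
        μ ⊗₁ id
          ∎))

  curry-ext : ∀ {A B C} {g g' : Hom C (A ⊸ B)} → ev ∘ (g ⊗₁ id) ≈ ev ∘ (g' ⊗₁ id) → g ≈ g'
  curry-ext p = Eq.trans (curry-unique Eq.refl) (Eq.sym (curry-unique (Eq.sym p)))

  ev-curry-∘ : ∀ {A B C D} {f : Hom (C ⊗₀ A) B} {g : Hom D C} →
               ev ∘ ((curry f ∘ g) ⊗₁ id) ≈ f ∘ (g ⊗₁ id)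
  ev-curry-∘ = Eq.trans (∘-resp-≈ʳ (Eq.trans (Eq.refl ⟩⊗⟨ Eq.sym identityˡ) ⊗-homomorphism))
                        (pullˡ curry-β)

  module InternalHom (A B : Algebra 𝕏 monad) where
    open Fusion A
    b = act B

    ⊸-act-uncurried : Hom (T₀ (carrier A ⊸ carrier B) ⊗₀ carrier A) (carrier B)
    ⊸-act-uncurried = b ∘ (T₁ ev ∘ ω⁻¹)

    ⊸-act : Hom (T₀ (carrier A ⊸ carrier B)) (carrier A ⊸ carrier B)
    ⊸-act = curry ⊸-act-uncurried

    ⊸-act-η : ⊸-act ∘ η ≈ id
    ⊸-act-η = curry-ext (begin
        ev ∘ ((⊸-act ∘ η) ⊗₁ id)            ≈⟨ ev-curry-∘ ⟩
        (b ∘ (T₁ ev ∘ ω⁻¹)) ∘ (η ⊗₁ id)     ≈⟨ Eq.trans assoc (∘-resp-≈ʳ (Eq.trans assoc (∘-resp-≈ʳ ω⁻¹-η))) ⟩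
        b ∘ (T₁ ev ∘ η)                     ≈⟨ ∘-resp-≈ʳ η-natural ⟨
        b ∘ (η ∘ ev)                        ≈⟨ Eq.trans (pullˡ (act-η B)) identityˡ ⟩
        ev                                  ≈⟨ Eq.trans (∘-resp-≈ʳ ⊗-identity) identityʳ ⟨
        ev ∘ (id ⊗₁ id)                     ∎)

    ⊸-act-uncurried-T⊗id : ∀ {C} {g : Hom C (carrier A ⊸ carrier B)} →
      ⊸-act-uncurried ∘ (T₁ g ⊗₁ id) ≈ b ∘ (T₁ (ev ∘ (g ⊗₁ id)) ∘ ω⁻¹)
    ⊸-act-uncurried-T⊗id = Eq.trans assoc (∘-resp-≈ʳ (Eq.trans assoc (Eq.trans (∘-resp-≈ʳ ω⁻¹-natural)
                             (Eq.trans sym-assoc (∘-resp-≈ˡ T-merge)))))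

    ⊸-act-μ : ⊸-act ∘ T₁ ⊸-act ≈ ⊸-act ∘ μ
    ⊸-act-μ = curry-ext (begin
        ev ∘ ((⊸-act ∘ T₁ ⊸-act) ⊗₁ id)                 ≈⟨ ev-curry-∘ ⟩
        ⊸-act-uncurried ∘ (T₁ ⊸-act ⊗₁ id)              ≈⟨ ⊸-act-uncurried-T⊗id ⟩
        b ∘ (T₁ (ev ∘ (⊸-act ⊗₁ id)) ∘ ω⁻¹)             ≈⟨ ∘-resp-≈ʳ (∘-resp-≈ˡ (T-resp-≈ curry-β)) ⟩
        b ∘ (T₁ (b ∘ (T₁ ev ∘ ω⁻¹)) ∘ ω⁻¹)              ≈⟨ ∘-resp-≈ʳ (∘-resp-≈ˡ (Eq.trans T-homomorphism
                                                            (∘-resp-≈ʳ T-homomorphism))) ⟩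
        b ∘ ((T₁ b ∘ (T₁ (T₁ ev) ∘ T₁ ω⁻¹)) ∘ ω⁻¹)      ≈⟨ ∘-resp-≈ʳ assoc ⟩
        b ∘ (T₁ b ∘ ((T₁ (T₁ ev) ∘ T₁ ω⁻¹) ∘ ω⁻¹))      ≈⟨ pullˡ (act-μ B) ⟩
        (b ∘ μ) ∘ ((T₁ (T₁ ev) ∘ T₁ ω⁻¹) ∘ ω⁻¹)         ≈⟨ Eq.trans assoc (∘-resp-≈ʳ (Eq.trans (∘-resp-≈ʳ assoc)
                                                            (pullˡ μ-natural))) ⟩
        b ∘ ((T₁ ev ∘ μ) ∘ (T₁ ω⁻¹ ∘ ω⁻¹))              ≈⟨ ∘-resp-≈ʳ (Eq.trans assoc (∘-resp-≈ʳ (Eq.sym ω⁻¹-μ))) ⟩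
        b ∘ (T₁ ev ∘ (ω⁻¹ ∘ (μ ⊗₁ id)))                 ≈⟨ Eq.trans (∘-resp-≈ʳ sym-assoc) sym-assoc ⟩
        ⊸-act-uncurried ∘ (μ ⊗₁ id)                     ≈⟨ ev-curry-∘ ⟨
        ev ∘ ((⊸-act ∘ μ) ⊗₁ id)                        ∎)

    ⊸ᴬ : Algebra 𝕏 monad
    ⊸ᴬ = record { carrier = carrier A ⊸ carrier B ; act = ⊸-act ; act-η = ⊸-act-η ; act-μ = ⊸-act-μ }

    evᴴ : AlgHom 𝕏 monad (⊸ᴬ ⊗ᴬ A) B
    evᴴ = record
      { arr = ev
      ; commutes = begin
          ev ∘ ((⊸-act ⊗₁ a) ∘ n)               ≈⟨ ∘-resp-≈ʳ (Eq.trans (∘-resp-≈ˡ serialize₁₂) assoc) ⟩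
          ev ∘ ((⊸-act ⊗₁ id) ∘ ω)              ≈⟨ pullˡ curry-β ⟩
          (b ∘ (T₁ ev ∘ ω⁻¹)) ∘ ω               ≈⟨ Eq.trans assoc (∘-resp-≈ʳ (Eq.trans assoc
                                                     (Eq.trans (∘-resp-≈ʳ ω⁻¹∘ω) identityʳ))) ⟩
          b ∘ T₁ ev                             ∎
      }

    curryᴴ : ∀ {C} → AlgHom 𝕏 monad (C ⊗ᴬ A) B → AlgHom 𝕏 monad C ⊸ᴬ
    curryᴴ {C} f = record
      { arr = curry (arr f)
      ; commutes = curry-ext (begin
          ev ∘ ((curry (arr f) ∘ c) ⊗₁ id)
            ≈⟨ ev-curry-∘ ⟩
          arr f ∘ (c ⊗₁ id)
            ≈⟨ ∘-resp-≈ʳ (Eq.trans (∘-resp-≈ʳ ω∘ω⁻¹) identityʳ) ⟨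
          arr f ∘ ((c ⊗₁ id) ∘ (ω ∘ ω⁻¹))
            ≈⟨ ∘-resp-≈ʳ (Eq.trans sym-assoc (∘-resp-≈ˡ
                (Eq.trans sym-assoc (∘-resp-≈ˡ (Eq.sym serialize₁₂))))) ⟩
          arr f ∘ (((c ⊗₁ a) ∘ n) ∘ ω⁻¹)
            ≈⟨ Eq.trans sym-assoc (Eq.trans (∘-resp-≈ˡ (commutes f)) assoc) ⟩
          b ∘ (T₁ (arr f) ∘ ω⁻¹)
            ≈⟨ ∘-resp-≈ʳ (∘-resp-≈ˡ (T-resp-≈ curry-β)) ⟨
          b ∘ (T₁ (ev ∘ (curry (arr f) ⊗₁ id)) ∘ ω⁻¹)
            ≈⟨ ⊸-act-uncurried-T⊗id ⟨
          ⊸-act-uncurried ∘ (T₁ (curry (arr f)) ⊗₁ id)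
            ≈⟨ ev-curry-∘ ⟨
          ev ∘ ((⊸-act ∘ T₁ (curry (arr f))) ⊗₁ id)
            ∎)
      }
      where c = act C

  closedᴱ : Closed (EM 𝕏 monad) monoidalᴱ
  closedᴱ = record
    { _⊸_ = InternalHom.⊸ᴬ
    ; ev = λ {A} {B} → InternalHom.evᴴ A B
    ; curry = λ {A} {B} f → InternalHom.curryᴴ A B f
    ; curry-β = curry-β
    ; curry-unique = curry-unique
    }

module MixedDistributiveLawProperties
  {o h r : Level} {𝕏 : Category o h r} (M : SymmetricMonoidal 𝕏) (Ex : MonoidalCoalgebraModality 𝕏 M)
  (𝕋 : SymmetricComonoidalMonad 𝕏 M) (Λ : SymmetricMonoidalMixedDistributiveLaw 𝕏 M 𝕋 Ex) where
  open Category 𝕏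
  open SymmetricMonoidal M
  open MonoidalCoalgebraModality Ex
  open SymmetricComonoidalMonad 𝕋
  open SymmetricMonoidalMixedDistributiveLaw Λ
  open HomReasoning 𝕏
  open MonoidalReasoning 𝕏 M
  open CoalgebraModalityProperties 𝕏 M Ex
  open MonadProperties monad

  -- the lifting of T to !-coalgebras, applied to the cofree coalgebra (!A, δ)
  λ-coalgebra : ∀ {A} → Hom (T₀ (!₀ A)) (!₀ (T₀ (!₀ A)))
  λ-coalgebra = λ' ∘ T₁ δ

  λ-e : ∀ {A} → e ∘ λ' {A} ≈ nK ∘ T₁ e
  λ-e {A} = Eq.trans (e-universal _ λ-coalgebra e∘λ-coalgebraic)
                     (Eq.sym (e-universal _ λ-coalgebra nK∘Te-coalgebraic))
    where
      e∘λ-coalgebraic : mK ∘ (e ∘ λ' {A}) ≈ !₁ (e ∘ λ') ∘ λ-coalgebra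
      e∘λ-coalgebraic = begin
          mK ∘ (e ∘ λ')                       ≈⟨ pullˡ (Eq.sym !e-δ) ⟩
          (!₁ e ∘ δ) ∘ λ'                     ≈⟨ Eq.trans assoc (∘-resp-≈ʳ λ-δ) ⟩
          !₁ e ∘ (!₁ λ' ∘ (λ' ∘ T₁ δ))        ≈⟨ pullˡ !-merge ⟩
          !₁ (e ∘ λ') ∘ λ-coalgebra           ∎
      nK∘Te-coalgebraic : mK ∘ (nK ∘ T₁ e) ≈ !₁ (nK ∘ T₁ e) ∘ λ-coalgebra
      nK∘Te-coalgebraic = begin
          mK ∘ (nK ∘ T₁ e)
            ≈⟨ pullˡ (Eq.sym λ-mK) ⟩
          (!₁ nK ∘ (λ' ∘ T₁ mK)) ∘ T₁ e
            ≈⟨ Eq.trans assoc (∘-resp-≈ʳ (Eq.trans assoc (∘-resp-≈ʳ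
                (Eq.trans T-merge (Eq.trans (T-resp-≈ (Eq.sym !e-δ)) T-homomorphism))))) ⟩
          !₁ nK ∘ (λ' ∘ (T₁ (!₁ e) ∘ T₁ δ))
            ≈⟨ ∘-resp-≈ʳ (pullˡ λ-natural) ⟩
          !₁ nK ∘ ((!₁ (T₁ e) ∘ λ') ∘ T₁ δ)
            ≈⟨ Eq.trans (∘-resp-≈ʳ assoc) (pullˡ !-merge) ⟩
          !₁ (nK ∘ T₁ e) ∘ λ-coalgebra
            ∎

  λ-id : ∀ {A} → id ∘ λ' {A} ≈ λ' ∘ T₁ id
  λ-id = Eq.trans identityˡ (Eq.sym (Eq.trans (∘-resp-≈ʳ T-identity) identityʳ))

  π₁-λ : ∀ {B C} → π₁ ∘ ((λ' {B} ⊗₁ λ' {C}) ∘ n) ≈ λ' ∘ T₁ π₁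
  π₁-λ = begin
      (ρ ∘ (id ⊗₁ e)) ∘ ((λ' ⊗₁ λ') ∘ n)
        ≈⟨ Eq.trans assoc (∘-resp-≈ʳ (pullˡ ⊗-merge)) ⟩
      ρ ∘ (((id ∘ λ') ⊗₁ (e ∘ λ')) ∘ n)
        ≈⟨ ∘-resp-≈ʳ (∘-resp-≈ˡ (λ-id ⟩⊗⟨ λ-e)) ⟩
      ρ ∘ (((λ' ∘ T₁ id) ⊗₁ (nK ∘ T₁ e)) ∘ n)
        ≈⟨ ∘-resp-≈ʳ (Eq.trans (∘-resp-≈ˡ ⊗-homomorphism)
            (Eq.trans assoc (∘-resp-≈ʳ (Eq.sym n-natural)))) ⟩
      ρ ∘ ((λ' ⊗₁ nK) ∘ (n ∘ T₁ (id ⊗₁ e)))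
        ≈⟨ ∘-resp-≈ʳ (Eq.trans (∘-resp-≈ˡ serialize₁₂) assoc) ⟩
      ρ ∘ ((λ' ⊗₁ id) ∘ ((id ⊗₁ nK) ∘ (n ∘ T₁ (id ⊗₁ e))))
        ≈⟨ extendʳ ρ-natural ⟩
      λ' ∘ (ρ ∘ ((id ⊗₁ nK) ∘ (n ∘ T₁ (id ⊗₁ e))))
        ≈⟨ ∘-resp-≈ʳ (Eq.trans (∘-resp-≈ʳ sym-assoc) (pullˡ n-unitʳ)) ⟩
      λ' ∘ (T₁ ρ ∘ T₁ (id ⊗₁ e))
        ≈⟨ ∘-resp-≈ʳ T-merge ⟩
      λ' ∘ T₁ π₁
        ∎

  π₂-λ : ∀ {B C} → π₂ ∘ ((λ' {B} ⊗₁ λ' {C}) ∘ n) ≈ λ' ∘ T₁ π₂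
  π₂-λ = begin
      (ℓ ∘ (e ⊗₁ id)) ∘ ((λ' ⊗₁ λ') ∘ n)
        ≈⟨ Eq.trans assoc (∘-resp-≈ʳ (pullˡ ⊗-merge)) ⟩
      ℓ ∘ (((e ∘ λ') ⊗₁ (id ∘ λ')) ∘ n)
        ≈⟨ ∘-resp-≈ʳ (∘-resp-≈ˡ (λ-e ⟩⊗⟨ λ-id)) ⟩
      ℓ ∘ (((nK ∘ T₁ e) ⊗₁ (λ' ∘ T₁ id)) ∘ n)
        ≈⟨ ∘-resp-≈ʳ (Eq.trans (∘-resp-≈ˡ ⊗-homomorphism)
            (Eq.trans assoc (∘-resp-≈ʳ (Eq.sym n-natural)))) ⟩
      ℓ ∘ ((nK ⊗₁ λ') ∘ (n ∘ T₁ (e ⊗₁ id)))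
        ≈⟨ ∘-resp-≈ʳ (Eq.trans (∘-resp-≈ˡ serialize₂₁) assoc) ⟩
      ℓ ∘ ((id ⊗₁ λ') ∘ ((nK ⊗₁ id) ∘ (n ∘ T₁ (e ⊗₁ id))))
        ≈⟨ extendʳ ℓ-natural ⟩
      λ' ∘ (ℓ ∘ ((nK ⊗₁ id) ∘ (n ∘ T₁ (e ⊗₁ id))))
        ≈⟨ ∘-resp-≈ʳ (Eq.trans (∘-resp-≈ʳ sym-assoc) (pullˡ n-unitˡ)) ⟩
      λ' ∘ (T₁ ℓ ∘ T₁ (e ⊗₁ id))
        ≈⟨ ∘-resp-≈ʳ T-merge ⟩
      λ' ∘ T₁ π₂
        ∎

  λ-Δ : ∀ {A} → Δ ∘ λ' {A} ≈ (λ' ⊗₁ λ') ∘ (n ∘ T₁ Δ)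
  λ-Δ {A} = !⊗!-ext (Δ ∘ λ') ((λ' ⊗₁ λ') ∘ (n ∘ T₁ Δ)) λ-coalgebra
              Δ∘λ-coalgebraic split-coalgebraic
              (same-projection π₁∘Δ π₁∘Δ π₁-λ)
              (same-projection π₂∘Δ π₂∘Δ π₂-λ)
    where
      Δ∘λ-coalgebraic : m ∘ ((δ ⊗₁ δ) ∘ (Δ ∘ λ' {A})) ≈ !₁ (Δ ∘ λ') ∘ λ-coalgebra
      Δ∘λ-coalgebraic = begin
          m ∘ ((δ ⊗₁ δ) ∘ (Δ ∘ λ'))          ≈⟨ Eq.trans (∘-resp-≈ʳ sym-assoc) sym-assoc ⟩
          (m ∘ ((δ ⊗₁ δ) ∘ Δ)) ∘ λ'          ≈⟨ ∘-resp-≈ˡ !Δ-δ ⟨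
          (!₁ Δ ∘ δ) ∘ λ'                    ≈⟨ Eq.trans assoc (∘-resp-≈ʳ λ-δ) ⟩
          !₁ Δ ∘ (!₁ λ' ∘ λ-coalgebra)       ≈⟨ pullˡ !-merge ⟩
          !₁ (Δ ∘ λ') ∘ λ-coalgebra          ∎
      split-coalgebraic : m ∘ ((δ ⊗₁ δ) ∘ ((λ' ⊗₁ λ') ∘ (n ∘ T₁ Δ)))
                            ≈ !₁ ((λ' ⊗₁ λ') ∘ (n ∘ T₁ Δ)) ∘ λ-coalgebra
      split-coalgebraic = begin
          m ∘ ((δ ⊗₁ δ) ∘ ((λ' ⊗₁ λ') ∘ (n ∘ T₁ Δ)))
            ≈⟨ ∘-resp-≈ʳ (pullˡ (Eq.trans ⊗-merge (Eq.trans (λ-δ ⟩⊗⟨ λ-δ)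
                 (Eq.trans ⊗-homomorphism (∘-resp-≈ʳ ⊗-homomorphism))))) ⟩
          m ∘ (((!₁ λ' ⊗₁ !₁ λ') ∘ ((λ' ⊗₁ λ') ∘ (T₁ δ ⊗₁ T₁ δ))) ∘ (n ∘ T₁ Δ))
            ≈⟨ ∘-resp-≈ʳ (Eq.trans assoc (∘-resp-≈ʳ (Eq.trans assoc (∘-resp-≈ʳ (Eq.sym (extendʳ n-natural)))))) ⟩
          m ∘ ((!₁ λ' ⊗₁ !₁ λ') ∘ ((λ' ⊗₁ λ') ∘ (n ∘ (T₁ (δ ⊗₁ δ) ∘ T₁ Δ))))
            ≈⟨ extendʳ m-natural ⟩
          !₁ (λ' ⊗₁ λ') ∘ (m ∘ ((λ' ⊗₁ λ') ∘ (n ∘ (T₁ (δ ⊗₁ δ) ∘ T₁ Δ))))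
            ≈⟨ ∘-resp-≈ʳ (Eq.trans (Eq.trans (∘-resp-≈ʳ sym-assoc) sym-assoc) (∘-resp-≈ˡ (Eq.sym λ-m))) ⟩
          !₁ (λ' ⊗₁ λ') ∘ ((!₁ n ∘ (λ' ∘ T₁ m)) ∘ (T₁ (δ ⊗₁ δ) ∘ T₁ Δ))
            ≈⟨ ∘-resp-≈ʳ (Eq.trans assoc (∘-resp-≈ʳ (Eq.trans assoc (∘-resp-≈ʳ
                 (Eq.trans (∘-resp-≈ʳ T-merge) T-merge))))) ⟩
          !₁ (λ' ⊗₁ λ') ∘ (!₁ n ∘ (λ' ∘ T₁ (m ∘ ((δ ⊗₁ δ) ∘ Δ))))
            ≈⟨ ∘-resp-≈ʳ (∘-resp-≈ʳ (∘-resp-≈ʳ (Eq.trans (T-resp-≈ (Eq.sym !Δ-δ)) T-homomorphism))) ⟩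
          !₁ (λ' ⊗₁ λ') ∘ (!₁ n ∘ (λ' ∘ (T₁ (!₁ Δ) ∘ T₁ δ)))
            ≈⟨ ∘-resp-≈ʳ (∘-resp-≈ʳ (extendʳ λ-natural)) ⟩
          !₁ (λ' ⊗₁ λ') ∘ (!₁ n ∘ (!₁ (T₁ Δ) ∘ λ-coalgebra))
            ≈⟨ Eq.trans (∘-resp-≈ʳ (pullˡ !-merge)) (pullˡ !-merge) ⟩
          !₁ ((λ' ⊗₁ λ') ∘ (n ∘ T₁ Δ)) ∘ λ-coalgebra
            ∎
      same-projection : {π : Hom (!₀ (T₀ A) ⊗₀ !₀ (T₀ A)) (!₀ (T₀ A))} {π' : Hom (!₀ A ⊗₀ !₀ A) (!₀ A)} →
        π ∘ Δ ≈ id → π' ∘ Δ ≈ id → π ∘ ((λ' ⊗₁ λ') ∘ n) ≈ λ' ∘ T₁ π' →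
        π ∘ (Δ ∘ λ') ≈ π ∘ ((λ' ⊗₁ λ') ∘ (n ∘ T₁ Δ))
      same-projection {π} {π'} π∘Δ π'∘Δ π-λ = begin
          π ∘ (Δ ∘ λ')                       ≈⟨ Eq.trans (pullˡ π∘Δ) identityˡ ⟩
          λ'                                 ≈⟨ Eq.trans (∘-resp-≈ʳ (Eq.trans T-merge (T-≈id π'∘Δ))) identityʳ ⟨
          λ' ∘ (T₁ π' ∘ T₁ Δ)                ≈⟨ Eq.trans sym-assoc (∘-resp-≈ˡ (Eq.sym π-λ)) ⟩
          (π ∘ ((λ' ⊗₁ λ') ∘ n)) ∘ T₁ Δ      ≈⟨ Eq.trans assoc (∘-resp-≈ʳ assoc) ⟩
          π ∘ ((λ' ⊗₁ λ') ∘ (n ∘ T₁ Δ))      ∎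

module EMModality
  {o h r : Level} {𝕏 : Category o h r} (M : SymmetricMonoidal 𝕏) (Ex : MonoidalCoalgebraModality 𝕏 M)
  (𝕋 : SymmetricComonoidalMonad 𝕏 M) (Λ : SymmetricMonoidalMixedDistributiveLaw 𝕏 M 𝕋 Ex) where
  open Category 𝕏
  open SymmetricMonoidal M
  open MonoidalCoalgebraModality Ex
  open SymmetricComonoidalMonad 𝕋
  open SymmetricMonoidalMixedDistributiveLaw Λ
  open HomReasoning 𝕏
  open MonoidalReasoning 𝕏 M
  open CoalgebraModalityProperties 𝕏 M Ex using (!-merge)
  open MixedDistributiveLawProperties M Ex 𝕋 Λ using (λ-e; λ-Δ)
  open EMMonoidal M 𝕋
  open Algebra
  open AlgHom

  !ᴬ : Algebra 𝕏 monad → Algebra 𝕏 monad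
  !ᴬ A = record
    { carrier = !₀ (carrier A)
    ; act = !₁ a ∘ λ'
    ; act-η = Eq.trans assoc (Eq.trans (∘-resp-≈ʳ λ-η)
                (Eq.trans !-merge (Eq.trans (!-resp-≈ (act-η A)) !-identity)))
    ; act-μ = begin
        (!₁ a ∘ λ') ∘ T₁ (!₁ a ∘ λ')        ≈⟨ Eq.trans assoc (∘-resp-≈ʳ (Eq.trans (∘-resp-≈ʳ T-homomorphism)
                                                (pullˡ λ-natural))) ⟩
        !₁ a ∘ ((!₁ (T₁ a) ∘ λ') ∘ T₁ λ')   ≈⟨ Eq.trans (∘-resp-≈ʳ assoc) (pullˡ (Eq.trans !-merge
                                                (Eq.trans (!-resp-≈ (act-μ A)) !-homomorphism))) ⟩
        (!₁ a ∘ !₁ μ) ∘ (λ' ∘ T₁ λ')        ≈⟨ Eq.trans assoc (∘-resp-≈ʳ (Eq.sym λ-μ)) ⟩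
        !₁ a ∘ (λ' ∘ μ)                     ≈⟨ sym-assoc ⟩
        (!₁ a ∘ λ') ∘ μ                     ∎
    }
    where a = act A

  !ᴴ : ∀ {A B} → AlgHom 𝕏 monad A B → AlgHom 𝕏 monad (!ᴬ A) (!ᴬ B)
  !ᴴ {A} {B} f = record
    { arr = !₁ (arr f)
    ; commutes = begin
        !₁ (arr f) ∘ (!₁ (act A) ∘ λ')       ≈⟨ pullˡ (Eq.trans !-merge (Eq.trans (!-resp-≈ (commutes f))
                                                 !-homomorphism)) ⟩
        (!₁ (act B) ∘ !₁ (T₁ (arr f))) ∘ λ'  ≈⟨ Eq.trans assoc (Eq.trans (∘-resp-≈ʳ (Eq.sym λ-natural)) sym-assoc) ⟩
        (!₁ (act B) ∘ λ') ∘ T₁ (!₁ (arr f))  ∎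
    }

  δᴴ : ∀ {A} → AlgHom 𝕏 monad (!ᴬ A) (!ᴬ (!ᴬ A))
  δᴴ {A} = record
    { arr = δ
    ; commutes = begin
        δ ∘ (!₁ (act A) ∘ λ')                       ≈⟨ extendʳ δ-natural ⟩
        !₁ (!₁ (act A)) ∘ (δ ∘ λ')                  ≈⟨ ∘-resp-≈ʳ λ-δ ⟩
        !₁ (!₁ (act A)) ∘ (!₁ λ' ∘ (λ' ∘ T₁ δ))     ≈⟨ Eq.trans (pullˡ !-merge) sym-assoc ⟩
        (!₁ (!₁ (act A) ∘ λ') ∘ λ') ∘ T₁ δ          ∎
    }

  εᴴ : ∀ {A} → AlgHom 𝕏 monad (!ᴬ A) A
  εᴴ = record { arr = ε ; commutes = Eq.trans (extendʳ ε-natural) (∘-resp-≈ʳ λ-ε) }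

  Δᴴ : ∀ {A} → AlgHom 𝕏 monad (!ᴬ A) (!ᴬ A ⊗ᴬ !ᴬ A)
  Δᴴ {A} = record
    { arr = Δ
    ; commutes = begin
        Δ ∘ (!₁ (act A) ∘ λ')                                       ≈⟨ extendʳ Δ-natural ⟩
        (!₁ (act A) ⊗₁ !₁ (act A)) ∘ (Δ ∘ λ')                       ≈⟨ ∘-resp-≈ʳ λ-Δ ⟩
        (!₁ (act A) ⊗₁ !₁ (act A)) ∘ ((λ' ⊗₁ λ') ∘ (n ∘ T₁ Δ))      ≈⟨ Eq.trans (pullˡ ⊗-merge) sym-assoc ⟩
        (((!₁ (act A) ∘ λ') ⊗₁ (!₁ (act A) ∘ λ')) ∘ n) ∘ T₁ Δ       ∎
    }

  eᴴ : ∀ {A} → AlgHom 𝕏 monad (!ᴬ A) Kᴬ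
  eᴴ = record { arr = e ; commutes = Eq.trans (pullˡ e-natural) λ-e }

  mᴴ : ∀ {A B} → AlgHom 𝕏 monad (!ᴬ A ⊗ᴬ !ᴬ B) (!ᴬ (A ⊗ᴬ B))
  mᴴ {A} {B} = record
    { arr = m
    ; commutes = begin
        m ∘ (((!₁ (act A) ∘ λ') ⊗₁ (!₁ (act B) ∘ λ')) ∘ n)   ≈⟨ ∘-resp-≈ʳ (Eq.trans (∘-resp-≈ˡ ⊗-homomorphism) assoc) ⟩
        m ∘ ((!₁ (act A) ⊗₁ !₁ (act B)) ∘ ((λ' ⊗₁ λ') ∘ n))  ≈⟨ extendʳ m-natural ⟩
        !₁ (act A ⊗₁ act B) ∘ (m ∘ ((λ' ⊗₁ λ') ∘ n))         ≈⟨ ∘-resp-≈ʳ λ-m ⟨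
        !₁ (act A ⊗₁ act B) ∘ (!₁ n ∘ (λ' ∘ T₁ m))           ≈⟨ Eq.trans (pullˡ !-merge) sym-assoc ⟩
        (!₁ ((act A ⊗₁ act B) ∘ n) ∘ λ') ∘ T₁ m              ∎
    }

  mKᴴ : AlgHom 𝕏 monad Kᴬ (!ᴬ Kᴬ)
  mKᴴ = record { arr = mK ; commutes = Eq.trans (Eq.sym λ-mK) sym-assoc }

  modalityᴱ : MonoidalCoalgebraModality (EM 𝕏 monad) monoidalᴱ
  modalityᴱ = record
    { !₀ = !ᴬ
    ; !₁ = !ᴴ
    ; !-identity = !-identity
    ; !-homomorphism = !-homomorphism
    ; !-resp-≈ = !-resp-≈
    ; δ = δᴴ
    ; ε = εᴴ
    ; δ-natural = δ-natural
    ; ε-natural = ε-natural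
    ; comonad-identityˡ = comonad-identityˡ
    ; comonad-identityʳ = comonad-identityʳ
    ; comonad-assoc = comonad-assoc
    ; m = mᴴ
    ; mK = mKᴴ
    ; m-natural = m-natural
    ; m-assoc = m-assoc
    ; m-unitˡ = m-unitˡ
    ; m-unitʳ = m-unitʳ
    ; m-symmetric = m-symmetric
    ; δ-m = δ-m
    ; δ-mK = δ-mK
    ; ε-m = ε-m
    ; ε-mK = ε-mK
    ; Δ = Δᴴ
    ; e = eᴴ
    ; Δ-natural = Δ-natural
    ; e-natural = e-natural
    ; counitˡ = counitˡ
    ; counitʳ = counitʳ
    ; coassoc = coassoc
    ; cocommutative = cocommutative
    ; δ-Δ = δ-Δ
    ; δ-e = δ-e
    ; Δ-m = Δ-m
    ; e-m = e-m
    ; Δ-mK = Δ-mK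
    ; e-mK = e-mK
    ; !Δ-δ = !Δ-δ
    ; !e-δ = !e-δ
    }

module EMLinear {o h r : Level} {𝕏 : Category o h r} (L : LinearCategory 𝕏) (𝕋 : MELLLiftingMonad 𝕏 L) where
  open LinearCategory L using (monoidal; closed; modality)
  open MELLLiftingMonad 𝕋 using (monad; comonoidalMonad; hopf; distributiveLaw)
  open Category 𝕏 using (module Eq)

  linearᴱ : LinearCategory (EM 𝕏 monad)
  linearᴱ = record
    { monoidal = EMMonoidal.monoidalᴱ monoidal comonoidalMonad
    ; closed = EMClosed.closedᴱ monoidal closed comonoidalMonad hopf
    ; modality = EMModality.modalityᴱ monoidal modality comonoidalMonad distributiveLaw
    }

  forgetful-strict : StrictLift 𝕋 linearᴱ
  forgetful-strict = record
    { ⊗-obj = λ _ _ → refl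
    ; ⊗-act = λ _ _ → Eq.refl
    ; ⊗-arr = λ _ _ → Eq.refl
    ; K-obj = refl
    ; K-act = Eq.refl
    ; α-arr = Eq.refl
    ; ℓ-arr = Eq.refl
    ; ρ-arr = Eq.refl
    ; σ-arr = Eq.refl
    ; ⊸-obj = λ _ _ → refl
    ; ev-arr = Eq.refl
    ; !-obj = λ _ → refl
    ; !-arr = λ _ → Eq.refl
    ; δ-arr = Eq.refl
    ; ε-arr = Eq.refl
    ; Δ-arr = Eq.refl
    ; e-arr = Eq.refl
    ; m-arr = Eq.refl
    ; mK-arr = Eq.refl
    }

theorem6p9 : {o h r : Level} {𝕏 : Category o h r} (L : LinearCategory 𝕏)
    (𝕋 : MELLLiftingMonad 𝕏 L) →
    Σ (LinearCategory (EM 𝕏 (MELLLiftingMonad.monad 𝕋))) (StrictLift 𝕋)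
theorem6p9 L 𝕋 = EMLinear.linearᴱ L 𝕋 , EMLinear.forgetful-strict L 𝕋
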